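{- Let $\pi=[a_1,\dots,a_n]$ be a permutation of $\{1,\dots,n\}$ and let $\mathrm{OG}(\pi)$ be its overlap graph, with vertex $v_i$ corresponding to the pointer $(i,i+1)$, $0\le i\le n$. For $1\le p,q\le n-1$, the operation $\textbf{gcds}_{\{v_p,v_q\}}(\mathrm{OG}(\pi))$ is defined if and only if $\textbf{cds}_{\{(p,p+1),(q,q+1)\}}(\pi)$ is defined, and in that case $\textbf{gcds}_{\{v_p,v_q\}}(\mathrm{OG}(\pi))=\mathrm{OG}(\textbf{cds}_{\{(p,p+1),(q,q+1)\}}(\pi))$.
   Context: Frame $\pi$ as the sequence $0,a_1,\dots,a_n,n+1$. Each entry $k$ carries a left pointer $(k-1,k)$ immediately to its left and a right pointer $(k,k+1)$ immediately to its right, except that $0$ has no left pointer and $n+1$ has no right pointer. Reading left to right gives a sequence of $2(n+1)$ pointer occurrences in which each pointer $(i,i+1)$, $0\le i\le n$, occurs exactly twice. The overlap graph $\mathrm{OG}(\pi)$ has vertex set $\{v_0,\dots,v_n\}$ with $v_i\leftrightarrow (i,i+1)$; $v_i,v_j$ are adjacent iff their occurrences interleave, i.e. exactly one occurrence of $(j,j+1)$ lies strictly between the two occurrences of $(i,i+1)$. The roots are $v_0$ and $v_n$ (the root pointers $(0,1)$ and $(n,n+1)$). Context directed swap: for non-root pointers $p,q$ whose occurrences appear in the order $\dots p\dots q\dots p\dots q\dots$, write $\pi=[\alpha_1\,{}^p][\alpha_2\,{}^q][\alpha_3][{}^p\,\alpha_4][{}^q\,\alpha_5]$ where the $\alpha_i$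 are consecutive blocks; then $\textbf{cds}_{\{p,q\}}(\pi)=[\alpha_1\,{}^p][{}^p\,\alpha_4][\alpha_3][\alpha_2\,{}^q][{}^q\,\alpha_5]$ (the blocks between the first $p$ and first $q$ and between the second $p$ and second $q$ are interchanged); it is undefined if $p,q$ do not interleave. For a two-rooted graph and adjacent non-root vertices $x,y$, with $f_a(b)=1$ iff $a,b$ adjacent, $\textbf{gcds}_{\{x,y\}}(G)$ is the graph on the same vertices where distinct $u,v$ are adjacent iff $f_x(u)f_y(v)+f_y(u)f_x(v)+f_u(v)\equiv1\pmod 2$; it is undefined otherwise. -}

module Defs where

open import Data.Nat.Base using (ℕ; zero; suc; _∸_; _≡ᵇ_; _≤ᵇ_; _<ᵇ_)
open import Data.Bool.Base using (Bool; true; false; if_then_else_; _∧_; _∨_; not; _xor_)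
open import Data.List.Base using (List; []; _∷_; _++_; [_]; map; take; drop)
open import Data.Product.Base using (_×_; _,_; proj₁)
open import Data.Maybe.Base using (Maybe; just; nothing)
open import Data.Fin.Base using (Fin; toℕ)

framed : ℕ → List ℕ → List ℕ
framed n π = 0 ∷ (π ++ [ suc n ])

-- Each occurrence is (i , c) : the pointer (i,i+1) together with the cut
-- position (gap index in the framed sequence) it sits at: the left pointer of
-- the entry at position j sits at gap j (just before it), the right pointer
-- at gap j+1 (just after it).
annot : ℕ → ℕ → List ℕ → List (ℕ × ℕ)
annot n j [] = []
annot n j (k ∷ ks) =
  (if k ≡ᵇ 0 then [] else [ (k ∸ 1 , j) ]) ++
  ((if k ≡ᵇ suc n then [] else [ (k , suc j) ]) ++ annot n (suc j) ks)

-- The sequence of pointer occurrences of π (pointer (i,i+1) written as i).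
ptrSeq : ℕ → List ℕ → List ℕ
ptrSeq n π = map proj₁ (annot n 0 (framed n π))

count : ℕ → List ℕ → ℕ
count x [] = 0
count x (y ∷ ys) = if x ≡ᵇ y then suc (count x ys) else count x ys

afterFirst : ℕ → List ℕ → List ℕ
afterFirst x [] = []
afterFirst x (y ∷ ys) = if x ≡ᵇ y then ys else afterFirst x ys

beforeFirst : ℕ → List ℕ → List ℕ
beforeFirst x [] = []
beforeFirst x (y ∷ ys) = if x ≡ᵇ y then [] else y ∷ beforeFirst x ys

between : ℕ → List ℕ → List ℕ
between x s = beforeFirst x (afterFirst x s)

Graph : ℕ → Set
Graph n = Fin (suc n) → Fin (suc n) → Bool

OG : (n : ℕ) → List ℕ → Graph n
OG n π u v =
  if toℕ u ≡ᵇ toℕ v then false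
  else count (toℕ v) (between (toℕ u) (ptrSeq n π)) ≡ᵇ 1

nonRoot : ℕ → ℕ → Bool
nonRoot n i = (1 ≤ᵇ i) ∧ (i <ᵇ n)

-- graph context directed swap; roots of the two-rooted graph are v_0 and v_n
gcds : (n : ℕ) → Graph n → Fin (suc n) → Fin (suc n) → Maybe (Graph n)
gcds n G x y =
  if nonRoot n (toℕ x) ∧ nonRoot n (toℕ y) ∧ f x y
  then just (λ u v → if toℕ u ≡ᵇ toℕ v then false
                     else ((f x u ∧ f y v) xor (f y u ∧ f x v)) xor f u v)
  else nothing
  where
  f : Fin (suc n) → Fin (suc n) → Bool
  f a b = if toℕ a ≡ᵇ toℕ b then false else G a b

filterP : ℕ → ℕ → List (ℕ × ℕ) → List (ℕ × ℕ)
filterP p q [] = []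
filterP p q ((i , c) ∷ xs) =
  if (i ≡ᵇ p) ∨ (i ≡ᵇ q) then (i , c) ∷ filterP p q xs else filterP p q xs

slice : ℕ → ℕ → List ℕ → List ℕ
slice a b xs = take (b ∸ a) (drop a xs)

swapBlocks : ℕ → ℕ → ℕ → ℕ → List ℕ → List ℕ
swapBlocks a b c d F =
  take a F ++ (slice c d F ++ (slice b c F ++ (slice a b F ++ drop d F)))

unframe : ℕ → List ℕ → List ℕ
unframe n xs = take n (drop 1 xs)

cds : ℕ → List ℕ → ℕ → ℕ → Maybe (List ℕ)
cds n π p q = go (filterP p q (annot n 0 (framed n π)))
  where
  go : List (ℕ × ℕ) → Maybe (List ℕ)
  go ((a1 , c1) ∷ (a2 , c2) ∷ (a3 , c3) ∷ (a4 , c4) ∷ []) =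
    if nonRoot n p ∧ nonRoot n q ∧ not (p ≡ᵇ q) ∧
       (((a1 ≡ᵇ p) ∧ (a2 ≡ᵇ q) ∧ (a3 ≡ᵇ p) ∧ (a4 ≡ᵇ q)) ∨
        ((a1 ≡ᵇ q) ∧ (a2 ≡ᵇ p) ∧ (a3 ≡ᵇ q) ∧ (a4 ≡ᵇ p)))
    then just (unframe n (swapBlocks c1 c2 c3 c4 (framed n π)))
    else nothing
  go _ = nothing

-- In the word of pointer occurrences every pointer occurs twice, so v_x and v_y overlap iff an odd
-- number of occurrences of y lies between the two occurrences of x, i.e. iff the number of pairs
-- (occurrence of y, later occurrence of x) is odd.  This pair parity is additive under
-- concatenation up to a product of single parities, which makes it computable blockwise.
-- The test inside cds succeeds exactly when the marked occurrences of p and q alternate, which is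
-- the overlap of v_p and v_q.  Cutting there writes the pointer word as W₁ a W₂ b W₃ a W₄ b W₅, and
-- cds turns it into W₁ W₄ W₃ W₂ W₅ with the two occurrences of a, and of b, reinserted adjacently.
-- Adjacent occurrences overlap nothing; for the remaining vertices u, v the pair parity changes by
-- overlap(a,u)·overlap(b,v) + overlap(b,u)·overlap(a,v), which is the gcds rule.

module Submission where

open import Defs
open import Algebra.Properties.CommutativeSemigroup using (interchange)
import Algebra.Solver.Monoid
open import Data.Bool.Base using (Bool; true; false; _∧_; _∨_; not; _xor_; if_then_else_)
open import Data.Bool.Properties
  using (xor-assoc; xor-comm; xor-same; xor-identityʳ; ∧-zeroʳ; ∧-comm; ∨-conicalˡ; ∨-conicalʳ;
         ∧-conicalˡ; ∧-conicalʳ; T-≡)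
open import Data.Bool.Solver using (module xor-∧-Solver)
open import Data.Empty using (⊥; ⊥-elim)
open import Data.Fin.Base using (Fin; toℕ)
open import Data.Fin.Properties using (toℕ<n)
open import Data.List.Base
  using (List; []; _∷_; _++_; [_]; _∷ʳ_; foldr; map; take; drop; length; upTo; initLast; _∷ʳ′_)
open import Data.List.Properties
  using (++-assoc; ++-identityʳ; ++-conicalʳ; ++-monoid; ∷-injectiveˡ; ∷ʳ-injective; map-++; map-upTo;
         upTo-∷ʳ; length-upTo; length-++; length-map; drop-drop)
open import Data.List.Relation.Unary.All using (All; []; _∷_)
import Data.List.Relation.Binary.Permutation.Propositional as ↭
open ↭ using (_↭_; ↭-reflexive; ↭-trans)
open import Data.List.Relation.Binary.Permutation.Propositional.Properties using (↭-length; ++⁺ʳ)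
open import Data.Maybe.Base using (Maybe; just; nothing; is-just)
open import Data.Nat.Base using (ℕ; zero; suc; _+_; _∸_; _≤_; _<_; z≤n; s≤s; _≡ᵇ_)
open import Data.Nat using (_<?_)
open import Data.Nat.Properties
  using (≡ᵇ⇒≡; ≡⇒≡ᵇ; ≤⇒≤ᵇ; <⇒<ᵇ; ≤-trans; ≤-refl; ≤-reflexive; ≤-pred; n≤1+n; <⇒≤; <⇒≢; ≮⇒≥;
         suc-injective; +-suc; +-comm; +-commutativeSemigroup; m+n∸n≡m; m≤n+m; m≤m+n; +-mono-≤; +-monoʳ-≤)
import Data.Nat.Solver
open import Data.Product.Base using (Σ; _×_; _,_; proj₁; proj₂)
open import Data.Sum.Base using (_⊎_; inj₁; inj₂) renaming (map to map-⊎)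
open import Data.Unit.Base using (⊤; tt)
open import Function.Base using (_∘_)
open import Function.Bundles using (_⇔_; mk⇔; Equivalence)
open import Relation.Nullary.Decidable.Core using (yes; no)
open import Relation.Nullary.Negation.Core using (contradiction)
open import Relation.Binary.PropositionalEquality hiding ([_])

module ++-Solver = Algebra.Solver.Monoid (++-monoid ℕ)

≡ᵇ-refl : ∀ n → (n ≡ᵇ n) ≡ true
≡ᵇ-refl n = Equivalence.to T-≡ (≡⇒≡ᵇ n n refl)

≡ᵇ-true⇒≡ : ∀ m n → (m ≡ᵇ n) ≡ true → m ≡ n
≡ᵇ-true⇒≡ m n e = ≡ᵇ⇒≡ m n (Equivalence.from T-≡ e)

≡ᵇ-sym : ∀ m n → (m ≡ᵇ n) ≡ (n ≡ᵇ m)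
≡ᵇ-sym zero    zero    = refl
≡ᵇ-sym zero    (suc n) = refl
≡ᵇ-sym (suc m) zero    = refl
≡ᵇ-sym (suc m) (suc n) = ≡ᵇ-sym m n

≢⇒≡ᵇ-false : ∀ {m n} → m ≢ n → (m ≡ᵇ n) ≡ false
≢⇒≡ᵇ-false {m} {n} m≢n with m ≡ᵇ n in e
... | true  = ⊥-elim (m≢n (≡ᵇ-true⇒≡ m n e))
... | false = refl

≡ᵇ-false-sym : ∀ m n → (m ≡ᵇ n) ≡ false → (n ≡ᵇ m) ≡ false
≡ᵇ-false-sym m n e = trans (≡ᵇ-sym n m) e

not-both-≡ᵇ : ∀ u v y → (u ≡ᵇ v) ≡ false → ((u ≡ᵇ y) ∧ (v ≡ᵇ y)) ≡ false
not-both-≡ᵇ u v y u≢v with u ≡ᵇ y in uy | v ≡ᵇ y in vy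
... | false | _     = refl
... | true  | false = refl
... | true  | true with refl ← ≡ᵇ-true⇒≡ u y uy | refl ← ≡ᵇ-true⇒≡ v y vy
  with () ← trans (sym u≢v) (≡ᵇ-refl y)

if-just : ∀ {A : Set} {c : Bool} {K G : A} → (if c then just K else nothing) ≡ just G → c ≡ true × K ≡ G
if-just {c = true} refl = refl , refl

all-≡ᵇ⇒≡ : ∀ a₁ b₁ a₂ b₂ a₃ b₃ a₄ b₄ → ((a₁ ≡ᵇ b₁) ∧ (a₂ ≡ᵇ b₂) ∧ (a₃ ≡ᵇ b₃) ∧ (a₄ ≡ᵇ b₄)) ≡ true →
  a₁ ≡ b₁ × a₂ ≡ b₂ × a₃ ≡ b₃ × a₄ ≡ b₄
all-≡ᵇ⇒≡ a₁ b₁ a₂ b₂ a₃ b₃ a₄ b₄ e with a₁ ≡ᵇ b₁ in e₁ | a₂ ≡ᵇ b₂ in e₂ | a₃ ≡ᵇ b₃ in e₃ | a₄ ≡ᵇ b₄ in e₄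
... | true | true | true | true =
  ≡ᵇ-true⇒≡ a₁ b₁ e₁ , ≡ᵇ-true⇒≡ a₂ b₂ e₂ , ≡ᵇ-true⇒≡ a₃ b₃ e₃ , ≡ᵇ-true⇒≡ a₄ b₄ e₄

if-else-cong : ∀ {A : Set} c {z x y : A} → (c ≡ false → x ≡ y) → (if c then z else x) ≡ (if c then z else y)
if-else-cong true  _ = refl
if-else-cong false h = h refl

not-true : ∀ x → not x ≡ true → x ≡ false
not-true false _ = refl

∨-true : ∀ x y → x ∨ y ≡ true → x ≡ true ⊎ y ≡ true
∨-true true  y _ = inj₁ refl
∨-true false y e = inj₂ e

is-just-if : ∀ {A : Set} c {K : A} → is-just (if c then just K else nothing) ≡ true ⇔ c ≡ true
is-just-if true  = mk⇔ (λ _ → refl) (λ _ → refl)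
is-just-if false = mk⇔ (λ ()) (λ ())

is-just⇒just : ∀ {A : Set} (m : Maybe A) → is-just m ≡ true → Σ A λ x → m ≡ just x
is-just⇒just (just x) _ = x , refl

nonRoot-true : ∀ {n i} → 1 ≤ i → i < n → nonRoot n i ≡ true
nonRoot-true 1≤i i<n =
  cong₂ _∧_ (Equivalence.to T-≡ (≤⇒≤ᵇ 1≤i)) (Equivalence.to T-≡ (<⇒<ᵇ i<n))

xor≡false⇒≡ : ∀ a b → a xor b ≡ false → a ≡ b
xor≡false⇒≡ false false _ = refl
xor≡false⇒≡ true  true  _ = refl

-- Parities of occurrences in a word

isOdd : ℕ → Bool
isOdd zero    = false
isOdd (suc n) = not (isOdd n)

parity : ℕ → List ℕ → Bool
parity u []       = false
parity u (y ∷ ys) = (u ≡ᵇ y) xor parity u ys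

-- Parity of the number of pairs (occurrence of v, later occurrence of u).
pairParity : ℕ → ℕ → List ℕ → Bool
pairParity u v []       = false
pairParity u v (y ∷ ys) = pairParity u v ys xor (parity u ys ∧ (v ≡ᵇ y))

count-++ : ∀ u X Y → count u (X ++ Y) ≡ count u X + count u Y
count-++ u []      Y = refl
count-++ u (y ∷ X) Y with u ≡ᵇ y
... | true  = cong suc (count-++ u X Y)
... | false = count-++ u X Y

parity≡isOdd-count : ∀ u X → parity u X ≡ isOdd (count u X)
parity≡isOdd-count u []       = refl
parity≡isOdd-count u (y ∷ ys) with u ≡ᵇ y
... | true  = cong not (parity≡isOdd-count u ys)
... | false = parity≡isOdd-count u ys

parity-count≡0 : ∀ u X → count u X ≡ 0 → parity u X ≡ false
parity-count≡0 u X e = trans (parity≡isOdd-count u X) (cong isOdd e)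

parity-count≡2 : ∀ u X → count u X ≡ 2 → parity u X ≡ false
parity-count≡2 u X e = trans (parity≡isOdd-count u X) (cong isOdd e)

parity-++ : ∀ u X Y → parity u (X ++ Y) ≡ parity u X xor parity u Y
parity-++ u []      Y = refl
parity-++ u (y ∷ X) Y =
  trans (cong ((u ≡ᵇ y) xor_) (parity-++ u X Y)) (sym (xor-assoc (u ≡ᵇ y) (parity u X) (parity u Y)))

pairParity-++ : ∀ u v X Y →
  pairParity u v (X ++ Y) ≡ pairParity u v X xor (pairParity u v Y xor (parity u Y ∧ parity v X))
pairParity-++ u v []      Y =
  sym (trans (cong (pairParity u v Y xor_) (∧-zeroʳ (parity u Y))) (xor-identityʳ _))
pairParity-++ u v (y ∷ X) Y
  rewrite pairParity-++ u v X Y | parity-++ u X Y =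
  shuffle (pairParity u v X) (pairParity u v Y) (parity u X) (parity u Y) (parity v X) (v ≡ᵇ y)
  where
  open xor-∧-Solver using (solve; _:+_; _:*_; _:=_)
  shuffle : ∀ nX nY pX pY qX e →
    (nX xor (nY xor (pY ∧ qX))) xor ((pX xor pY) ∧ e) ≡ (nX xor (pX ∧ e)) xor (nY xor (pY ∧ (e xor qX)))
  shuffle = solve 6 (λ nX nY pX pY qX e →
    (nX :+ (nY :+ (pY :* qX))) :+ ((pX :+ pY) :* e) := (nX :+ (pX :* e)) :+ (nY :+ (pY :* (e :+ qX)))) refl

pairParity-count≡0 : ∀ u v X → count u X ≡ 0 → pairParity u v X ≡ false
pairParity-count≡0 u v []       e = refl
pairParity-count≡0 u v (y ∷ ys) e with u ≡ᵇ y
... | false rewrite pairParity-count≡0 u v ys e | parity-count≡0 u ys e = refl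

pairParity≡parity-beforeFirst : ∀ u v X → count u X ≡ 1 → pairParity u v X ≡ parity v (beforeFirst u X)
pairParity≡parity-beforeFirst u v (y ∷ ys) e with u ≡ᵇ y
... | true  rewrite pairParity-count≡0 u v ys (suc-injective e) | parity-count≡0 u ys (suc-injective e) = refl
... | false rewrite pairParity≡parity-beforeFirst u v ys e | trans (parity≡isOdd-count u ys) (cong isOdd e) =
  xor-comm (parity v (beforeFirst u ys)) (v ≡ᵇ y)

pairParity≡parity-between : ∀ u v X → count u X ≡ 2 → (u ≡ᵇ v) ≡ false →
  pairParity u v X ≡ parity v (between u X)
pairParity≡parity-between u v (y ∷ ys) e u≢v with u ≡ᵇ y in uy
... | true with refl ← ≡ᵇ-true⇒≡ u y uy
  rewrite parity≡isOdd-count u ys | suc-injective e | ≡ᵇ-false-sym u v u≢v =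
  trans (xor-identityʳ _) (pairParity≡parity-beforeFirst u v ys (suc-injective e))
... | false rewrite parity≡isOdd-count u ys | e =
  trans (xor-identityʳ _) (pairParity≡parity-between u v ys e u≢v)

-- Overlaps in double occurrence words

-- OG n π u v is, by definition, overlaps (toℕ u) (toℕ v) (ptrSeq n π).
overlaps : ℕ → ℕ → List ℕ → Bool
overlaps x y w = if x ≡ᵇ y then false else (count y (between x w) ≡ᵇ 1)

count-afterFirst-≤ : ∀ v u X → count v (afterFirst u X) ≤ count v X
count-afterFirst-≤ v u []       = z≤n
count-afterFirst-≤ v u (y ∷ ys) with u ≡ᵇ y | v ≡ᵇ y
... | true  | true  = n≤1+n _
... | true  | false = ≤-refl
... | false | true  = ≤-trans (count-afterFirst-≤ v u ys) (n≤1+n _)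
... | false | false = count-afterFirst-≤ v u ys

count-beforeFirst-≤ : ∀ v u X → count v (beforeFirst u X) ≤ count v X
count-beforeFirst-≤ v u []       = z≤n
count-beforeFirst-≤ v u (y ∷ ys) with u ≡ᵇ y
... | true  = z≤n
... | false with v ≡ᵇ y
...   | true  = s≤s (count-beforeFirst-≤ v u ys)
...   | false = count-beforeFirst-≤ v u ys

count-between-≤ : ∀ v u X → count v (between u X) ≤ count v X
count-between-≤ v u X = ≤-trans (count-beforeFirst-≤ v u (afterFirst u X)) (count-afterFirst-≤ v u X)

≡ᵇ1≡isOdd : ∀ c → c ≤ 2 → (c ≡ᵇ 1) ≡ isOdd c
≡ᵇ1≡isOdd 0 _ = refl
≡ᵇ1≡isOdd 1 _ = refl
≡ᵇ1≡isOdd 2 _ = refl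
≡ᵇ1≡isOdd (suc (suc (suc _))) (s≤s (s≤s ()))

overlaps≡parity-between : ∀ x y w → (x ≡ᵇ y) ≡ false → count y w ≡ 2 →
  overlaps x y w ≡ parity y (between x w)
overlaps≡parity-between x y w x≢y cy rewrite x≢y =
  trans (≡ᵇ1≡isOdd _ (subst (count y (between x w) ≤_) cy (count-between-≤ y x w)))
        (sym (parity≡isOdd-count y (between x w)))

overlaps≡pairParity : ∀ x y w → (x ≡ᵇ y) ≡ false → count x w ≡ 2 → count y w ≡ 2 →
  overlaps x y w ≡ pairParity x y w
overlaps≡pairParity x y w x≢y cx cy =
  trans (overlaps≡parity-between x y w x≢y cy) (sym (pairParity≡parity-between x y w cx x≢y))

overlaps-between-[] : ∀ x y w → between x w ≡ [] → overlaps x y w ≡ false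
overlaps-between-[] x y w e with x ≡ᵇ y
... | true  = refl
... | false rewrite e = refl

overlaps-≢ : ∀ x y w → (x ≡ᵇ y) ≡ false → overlaps x y w ≡ (count y (between x w) ≡ᵇ 1)
overlaps-≢ x y w x≢y rewrite x≢y = refl

overlaps⇒≢ : ∀ x y w → overlaps x y w ≡ true → (x ≡ᵇ y) ≡ false
overlaps⇒≢ x y w e with x ≡ᵇ y
... | false = refl

overlaps⇒count : ∀ x y w → overlaps x y w ≡ true → count y (between x w) ≡ 1
overlaps⇒count x y w e = ≡ᵇ-true⇒≡ _ 1 (trans (sym (overlaps-≢ x y w (overlaps⇒≢ x y w e))) e)

pairParity-sym : ∀ u v X → (u ≡ᵇ v) ≡ false →
  pairParity u v X xor pairParity v u X ≡ parity u X ∧ parity v X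
pairParity-sym u v []       u≢v = refl
pairParity-sym u v (y ∷ ys) u≢v = begin
  (a xor (pu ∧ ev)) xor (b xor (pv ∧ eu))
    ≡⟨ expand a b pu pv eu ev ⟩
  ((eu xor pu) ∧ (ev xor pv)) xor (((a xor b) xor (pu ∧ pv)) xor (eu ∧ ev))
    ≡⟨ cong₂ (λ s t → ((eu xor pu) ∧ (ev xor pv)) xor (s xor t))
             (trans (cong (_xor (pu ∧ pv)) (pairParity-sym u v ys u≢v)) (xor-same (pu ∧ pv)))
             (not-both-≡ᵇ u v y u≢v) ⟩
  ((eu xor pu) ∧ (ev xor pv)) xor false
    ≡⟨ xor-identityʳ _ ⟩
  (eu xor pu) ∧ (ev xor pv) ∎
  where
  open ≡-Reasoning
  a b pu pv eu ev : Bool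
  a  = pairParity u v ys
  b  = pairParity v u ys
  pu = parity u ys
  pv = parity v ys
  eu = u ≡ᵇ y
  ev = v ≡ᵇ y
  open xor-∧-Solver using (solve; _:+_; _:*_; _:=_)
  expand : ∀ a b pu pv eu ev → (a xor (pu ∧ ev)) xor (b xor (pv ∧ eu)) ≡
    ((eu xor pu) ∧ (ev xor pv)) xor (((a xor b) xor (pu ∧ pv)) xor (eu ∧ ev))
  expand = solve 6 (λ a b pu pv eu ev → (a :+ (pu :* ev)) :+ (b :+ (pv :* eu)) :=
    ((eu :+ pu) :* (ev :+ pv)) :+ (((a :+ b) :+ (pu :* pv)) :+ (eu :* ev))) refl

overlaps-sym : ∀ x y w → (x ≡ᵇ y) ≡ false → count x w ≡ 2 → count y w ≡ 2 →
  overlaps x y w ≡ overlaps y x w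
overlaps-sym x y w x≢y cx cy =
  trans (overlaps≡pairParity x y w x≢y cx cy)
   (trans (xor≡false⇒≡ _ _ (trans (pairParity-sym x y w x≢y) (cong (_∧ parity y w) (parity-count≡2 x w cx))))
          (sym (overlaps≡pairParity y x w (≡ᵇ-false-sym x y x≢y) cy cx)))

-- Concatenation acts on (pairParity u v, parity u, parity v) by the following product.
module Concatenation {A : Set} (_⊕_ _⊗_ : A → A → A) where

  _∙_ : A × A × A → A × A × A → A × A × A
  (n₁ , p₁ , q₁) ∙ (n₂ , p₂ , q₂) = n₁ ⊕ (n₂ ⊕ (p₂ ⊗ q₁)) , p₁ ⊕ p₂ , q₁ ⊕ q₂

  swapDefect : A × A × A → A × A × A → A × A × A → A
  swapDefect (_ , p₂ , q₂) (_ , p₃ , q₃) (_ , p₄ , q₄) =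
    ((p₂ ⊕ p₃) ⊗ (q₃ ⊕ q₄)) ⊕ ((p₃ ⊕ p₄) ⊗ (q₂ ⊕ q₃))

open Concatenation _xor_ _∧_

profile : ℕ → ℕ → List ℕ → Bool × Bool × Bool
profile u v X = pairParity u v X , parity u X , parity v X

profile-++ : ∀ u v X Y → profile u v (X ++ Y) ≡ profile u v X ∙ profile u v Y
profile-++ u v X Y rewrite pairParity-++ u v X Y | parity-++ u X Y | parity-++ v X Y = refl

profile-congˡ : ∀ u v X {Y Y′} → profile u v Y ≡ profile u v Y′ → profile u v (X ++ Y) ≡ profile u v (X ++ Y′)
profile-congˡ u v X {Y} {Y′} e =
  trans (profile-++ u v X Y) (trans (cong (profile u v X ∙_) e) (sym (profile-++ u v X Y′)))

profile-erase : ∀ u v D Y → count u D ≡ 0 → count v D ≡ 0 → profile u v (D ++ Y) ≡ profile u v Y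
profile-erase u v D Y cu cv
  rewrite profile-++ u v D Y | pairParity-count≡0 u v D cu | parity-count≡0 u D cu | parity-count≡0 v D cv =
  cong (_, parity u Y , parity v Y) (trans (cong (pairParity u v Y xor_) (∧-zeroʳ _)) (xor-identityʳ _))

∙-swap₂₄ : ∀ x₁ x₂ x₃ x₄ x₅ →
  proj₁ (x₁ ∙ (x₄ ∙ (x₃ ∙ (x₂ ∙ x₅)))) ≡ proj₁ (x₁ ∙ (x₂ ∙ (x₃ ∙ (x₄ ∙ x₅)))) xor swapDefect x₂ x₃ x₄
∙-swap₂₄ (n₁ , p₁ , q₁) (n₂ , p₂ , q₂) (n₃ , p₃ , q₃) (n₄ , p₄ , q₄) (n₅ , p₅ , q₅) =
  solve 15 (λ n₁ p₁ q₁ n₂ p₂ q₂ n₃ p₃ q₃ n₄ p₄ q₄ n₅ p₅ q₅ →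
    let open Concatenation _:+_ _:*_ renaming (_∙_ to _·_; swapDefect to defect) in
    proj₁ ((n₁ , p₁ , q₁) · ((n₄ , p₄ , q₄) · ((n₃ , p₃ , q₃) · ((n₂ , p₂ , q₂) · (n₅ , p₅ , q₅))))) :=
    proj₁ ((n₁ , p₁ , q₁) · ((n₂ , p₂ , q₂) · ((n₃ , p₃ , q₃) · ((n₄ , p₄ , q₄) · (n₅ , p₅ , q₅))))) :+
    defect (n₂ , p₂ , q₂) (n₃ , p₃ , q₃) (n₄ , p₄ , q₄))
    refl n₁ p₁ q₁ n₂ p₂ q₂ n₃ p₃ q₃ n₄ p₄ q₄ n₅ p₅ q₅
  where open xor-∧-Solver using (solve; _:+_; _:*_; _:=_)

pairParity-swap₂₄ : ∀ u v W₁ W₂ W₃ W₄ W₅ →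
  pairParity u v (W₁ ++ W₄ ++ W₃ ++ W₂ ++ W₅) ≡
  pairParity u v (W₁ ++ W₂ ++ W₃ ++ W₄ ++ W₅) xor swapDefect (profile u v W₂) (profile u v W₃) (profile u v W₄)
pairParity-swap₂₄ u v W₁ W₂ W₃ W₄ W₅ = begin
  proj₁ (profile u v (W₁ ++ W₄ ++ W₃ ++ W₂ ++ W₅))
    ≡⟨ cong proj₁ (profile-++₅ W₁ W₄ W₃ W₂ W₅) ⟩
  proj₁ (x W₁ ∙ (x W₄ ∙ (x W₃ ∙ (x W₂ ∙ x W₅))))
    ≡⟨ ∙-swap₂₄ (x W₁) (x W₂) (x W₃) (x W₄) (x W₅) ⟩
  proj₁ (x W₁ ∙ (x W₂ ∙ (x W₃ ∙ (x W₄ ∙ x W₅)))) xor d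
    ≡⟨ cong (λ t → proj₁ t xor d) (profile-++₅ W₁ W₂ W₃ W₄ W₅) ⟨
  proj₁ (profile u v (W₁ ++ W₂ ++ W₃ ++ W₄ ++ W₅)) xor d ∎
  where
  open ≡-Reasoning
  x : List ℕ → Bool × Bool × Bool
  x = profile u v
  d : Bool
  d = swapDefect (x W₂) (x W₃) (x W₄)
  profile-++₅ : ∀ A B C D E → x (A ++ B ++ C ++ D ++ E) ≡ x A ∙ (x B ∙ (x C ∙ (x D ∙ x E)))
  profile-++₅ A B C D E = begin
    x (A ++ B ++ C ++ D ++ E)               ≡⟨ profile-++ u v A _ ⟩
    x A ∙ x (B ++ C ++ D ++ E)              ≡⟨ cong (x A ∙_) (profile-++ u v B _) ⟩
    x A ∙ (x B ∙ x (C ++ D ++ E))           ≡⟨ cong (λ t → x A ∙ (x B ∙ t)) (profile-++ u v C _) ⟩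
    x A ∙ (x B ∙ (x C ∙ x (D ++ E)))        ≡⟨ cong (λ t → x A ∙ (x B ∙ (x C ∙ t))) (profile-++ u v D E) ⟩
    x A ∙ (x B ∙ (x C ∙ (x D ∙ x E)))       ∎

afterFirst-skip : ∀ a X Y → count a X ≡ 0 → afterFirst a (X ++ Y) ≡ afterFirst a Y
afterFirst-skip a []      Y e = refl
afterFirst-skip a (x ∷ X) Y e with a ≡ᵇ x
... | false = afterFirst-skip a X Y e

beforeFirst-skip : ∀ a X Y → count a X ≡ 0 → beforeFirst a (X ++ Y) ≡ X ++ beforeFirst a Y
beforeFirst-skip a []      Y e = refl
beforeFirst-skip a (x ∷ X) Y e with a ≡ᵇ x
... | false = cong (x ∷_) (beforeFirst-skip a X Y e)

afterFirst-here : ∀ a R → afterFirst a (a ∷ R) ≡ R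
afterFirst-here a R rewrite ≡ᵇ-refl a = refl

beforeFirst-here : ∀ a R → beforeFirst a (a ∷ R) ≡ []
beforeFirst-here a R rewrite ≡ᵇ-refl a = refl

between-skip : ∀ a X Y → count a X ≡ 0 → between a (X ++ Y) ≡ between a Y
between-skip a X Y e = cong (beforeFirst a) (afterFirst-skip a X Y e)

between-skip* : ∀ a R Ws → All (λ W → count a W ≡ 0) Ws → between a (foldr _++_ R Ws) ≡ between a R
between-skip* a R []       []       = refl
between-skip* a R (W ∷ Ws) (e ∷ es) = trans (between-skip a W _ e) (between-skip* a R Ws es)

between-enclosed : ∀ a Y R → count a Y ≡ 0 → between a (a ∷ Y ++ a ∷ R) ≡ Y
between-enclosed a Y R e rewrite afterFirst-here a (Y ++ a ∷ R) | beforeFirst-skip a Y (a ∷ R) e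
  | beforeFirst-here a R = ++-identityʳ Y

count-≢ : ∀ u y → (u ≡ᵇ y) ≡ false → count u [ y ] ≡ 0
count-≢ u y e rewrite e = refl

count-++-≡0 : ∀ u X Y → count u X ≡ 0 → count u Y ≡ 0 → count u (X ++ Y) ≡ 0
count-++-≡0 u X Y ex ey = trans (count-++ u X Y) (cong₂ _+_ ex ey)

count-++₅ : ∀ u A B C D E →
  count u (A ++ B ++ C ++ D ++ E) ≡ count u A + (count u B + (count u C + (count u D + count u E)))
count-++₅ u A B C D E
  rewrite count-++ u A (B ++ C ++ D ++ E) | count-++ u B (C ++ D ++ E) | count-++ u C (D ++ E)
        | count-++ u D E = refl

-- Exchanging two blocks of a double occurrence word

gcdsEdge : (ℕ → ℕ → Bool) → ℕ → ℕ → ℕ → ℕ → Bool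
gcdsEdge O x y u v = ((O x u ∧ O y v) xor (O y u ∧ O x v)) xor O u v

gcdsEdge-sym : ∀ O x y u v → O u v ≡ O v u → gcdsEdge O x y u v ≡ gcdsEdge O x y v u
gcdsEdge-sym O x y u v e =
  cong₂ _xor_ (trans (xor-comm (O x u ∧ O y v) (O y u ∧ O x v))
                     (cong₂ _xor_ (∧-comm (O y u) (O x v)) (∧-comm (O x u) (O y v))))
              e

gcdsEdge-swap : ∀ O x y u v → gcdsEdge O x y u v ≡ gcdsEdge O y x u v
gcdsEdge-swap O x y u v = cong (_xor O u v) (xor-comm (O x u ∧ O y v) (O y u ∧ O x v))

gcdsEdge-roles : ∀ {O a b p q u v} → (a ≡ p × b ≡ q) ⊎ (a ≡ q × b ≡ p) → gcdsEdge O a b u v ≡ gcdsEdge O p q u v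
gcdsEdge-roles                       (inj₁ (refl , refl)) = refl
gcdsEdge-roles {O} {a} {b} {u = u} {v} (inj₂ (refl , refl)) = gcdsEdge-swap O a b u v

AdjacentPair : ℕ → List ℕ → List ℕ → Set
AdjacentPair a X Y = (X ≡ a ∷ a ∷ [] × Y ≡ []) ⊎ (X ≡ [] × Y ≡ a ∷ a ∷ [])

Avoids : ℕ → ℕ → List ℕ → Set
Avoids a b X = count a X ≡ 0 × count b X ≡ 0

Avoids-roles : ∀ {a b p q X} → (a ≡ p × b ≡ q) ⊎ (a ≡ q × b ≡ p) → Avoids p q X → Avoids a b X
Avoids-roles (inj₁ (refl , refl)) free      = free
Avoids-roles (inj₂ (refl , refl)) (p∉ , q∉) = q∉ , p∉

-- before and after are the pointer words of π and of cds(π).  Exchanging W₂ and W₄ brings the two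
-- occurrences of a together, either at A₁ or at A₂ (the other one is empty), and likewise for b.
record DoubleSwap (a b : ℕ) : Set where
  field
    W₁ W₂ W₃ W₄ W₅ A₁ A₂ B₁ B₂ : List ℕ
    a≢b : (a ≡ᵇ b) ≡ false
    avoids₁ : Avoids a b W₁
    avoids₂ : Avoids a b W₂
    avoids₃ : Avoids a b W₃
    avoids₄ : Avoids a b W₄
    avoids₅ : Avoids a b W₅
    pairA : AdjacentPair a A₁ A₂
    pairB : AdjacentPair b B₁ B₂

  before : List ℕ
  before = W₁ ++ a ∷ W₂ ++ b ∷ W₃ ++ a ∷ W₄ ++ b ∷ W₅

  after : List ℕ
  after = W₁ ++ A₁ ++ W₄ ++ B₂ ++ W₃ ++ A₂ ++ W₂ ++ B₁ ++ W₅

between-adjacent : ∀ a R → between a (a ∷ a ∷ R) ≡ []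
between-adjacent a R rewrite afterFirst-here a (a ∷ R) = beforeFirst-here a R

AdjacentPair-avoids : ∀ {a X Y} u → (u ≡ᵇ a) ≡ false → AdjacentPair a X Y → count u X ≡ 0 × count u Y ≡ 0
AdjacentPair-avoids u u≢a (inj₁ (refl , refl)) rewrite u≢a = refl , refl
AdjacentPair-avoids u u≢a (inj₂ (refl , refl)) rewrite u≢a = refl , refl

AdjacentPair-count : ∀ {a X Y} u → AdjacentPair a X Y → count u X + count u Y ≡ count u [ a ] + count u [ a ]
AdjacentPair-count {a} u (inj₁ (refl , refl)) with u ≡ᵇ a
... | true  = refl
... | false = refl
AdjacentPair-count {a} u (inj₂ (refl , refl)) with u ≡ᵇ a
... | true  = refl
... | false = refl

module DoubleSwapProperties {a b : ℕ} (s : DoubleSwap a b) where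
  open DoubleSwap s

  private
    O : ℕ → ℕ → Bool
    O x y = overlaps x y before

    b≢a : (b ≡ᵇ a) ≡ false
    b≢a = ≡ᵇ-false-sym a b a≢b

  count-after : ∀ u → count u after ≡ count u before
  count-after u = begin
    count u after
      ≡⟨ count-++₅ u W₁ A₁ W₄ B₂ _ ⟩
    c W₁ + (c A₁ + (c W₄ + (c B₂ + c (W₃ ++ A₂ ++ W₂ ++ B₁ ++ W₅))))
      ≡⟨ cong (λ t → c W₁ + (c A₁ + (c W₄ + (c B₂ + t)))) (count-++₅ u W₃ A₂ W₂ B₁ W₅) ⟩
    c W₁ + (c A₁ + (c W₄ + (c B₂ + (c W₃ + (c A₂ + (c W₂ + (c B₁ + c W₅)))))))
      ≡⟨ regroup (c W₁) (c W₂) (c W₃) (c W₄) (c W₅) (c A₁) (c A₂) (c B₁) (c B₂) ⟩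
    total + ((c A₁ + c A₂) + (c B₁ + c B₂))
      ≡⟨ cong₂ (λ s t → total + (s + t)) (AdjacentPair-count u pairA) (AdjacentPair-count u pairB) ⟩
    total + ((c [ a ] + c [ a ]) + (c [ b ] + c [ b ]))
      ≡⟨ spread (c W₁) (c W₂) (c W₃) (c W₄) (c W₅) (c [ a ]) (c [ b ]) ⟩
    c W₁ + (c [ a ] + (c W₂ + (c [ b ] + (c W₃ + (c [ a ] + (c W₄ + (c [ b ] + c W₅)))))))
      ≡⟨ cong (λ t → c W₁ + (c [ a ] + (c W₂ + (c [ b ] + t)))) (count-++₅ u W₃ [ a ] W₄ [ b ] W₅) ⟨
    c W₁ + (c [ a ] + (c W₂ + (c [ b ] + c (W₃ ++ a ∷ W₄ ++ b ∷ W₅))))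
      ≡⟨ count-++₅ u W₁ [ a ] W₂ [ b ] _ ⟨
    count u before ∎
    where
    open ≡-Reasoning
    open Data.Nat.Solver.+-*-Solver using (solve; _:+_; _:=_)
    c : List ℕ → ℕ
    c = count u
    total : ℕ
    total = c W₁ + (c W₂ + (c W₃ + (c W₄ + c W₅)))
    regroup : ∀ w₁ w₂ w₃ w₄ w₅ x₁ y₁ x₂ y₂ → w₁ + (x₁ + (w₄ + (y₂ + (w₃ + (y₁ + (w₂ + (x₂ + w₅))))))) ≡
      (w₁ + (w₂ + (w₃ + (w₄ + w₅)))) + ((x₁ + y₁) + (x₂ + y₂))
    regroup = solve 9 (λ w₁ w₂ w₃ w₄ w₅ x₁ y₁ x₂ y₂ → w₁ :+ (x₁ :+ (w₄ :+ (y₂ :+ (w₃ :+ (y₁ :+ (w₂ :+ (x₂ :+ w₅))))))) :=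
      (w₁ :+ (w₂ :+ (w₃ :+ (w₄ :+ w₅)))) :+ ((x₁ :+ y₁) :+ (x₂ :+ y₂))) refl
    spread : ∀ w₁ w₂ w₃ w₄ w₅ α β → (w₁ + (w₂ + (w₃ + (w₄ + w₅)))) + ((α + α) + (β + β)) ≡
      w₁ + (α + (w₂ + (β + (w₃ + (α + (w₄ + (β + w₅)))))))
    spread = solve 7 (λ w₁ w₂ w₃ w₄ w₅ α β → (w₁ :+ (w₂ :+ (w₃ :+ (w₄ :+ w₅)))) :+ ((α :+ α) :+ (β :+ β)) :=
      w₁ :+ (α :+ (w₂ :+ (β :+ (w₃ :+ (α :+ (w₄ :+ (β :+ w₅)))))))) refl

  between-a-before : between a before ≡ W₂ ++ b ∷ W₃
  between-a-before = begin
    between a before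
      ≡⟨ between-skip a W₁ _ (proj₁ avoids₁) ⟩
    between a (a ∷ W₂ ++ b ∷ W₃ ++ a ∷ W₄ ++ b ∷ W₅)
      ≡⟨ cong (λ t → between a (a ∷ t)) (++-assoc W₂ (b ∷ W₃) _) ⟨
    between a (a ∷ (W₂ ++ b ∷ W₃) ++ a ∷ W₄ ++ b ∷ W₅)
      ≡⟨ between-enclosed a (W₂ ++ b ∷ W₃) _ a-free ⟩
    W₂ ++ b ∷ W₃ ∎
    where
    open ≡-Reasoning
    a-free : count a (W₂ ++ b ∷ W₃) ≡ 0
    a-free = count-++-≡0 a W₂ (b ∷ W₃) (proj₁ avoids₂) (count-++-≡0 a [ b ] W₃ (count-≢ a b a≢b) (proj₁ avoids₃))

  between-b-before : between b before ≡ W₃ ++ a ∷ W₄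
  between-b-before = begin
    between b before
      ≡⟨ between-skip* b _ (W₁ ∷ [ a ] ∷ W₂ ∷ []) (proj₂ avoids₁ ∷ count-≢ b a b≢a ∷ proj₂ avoids₂ ∷ []) ⟩
    between b (b ∷ W₃ ++ a ∷ W₄ ++ b ∷ W₅)
      ≡⟨ cong (λ t → between b (b ∷ t)) (++-assoc W₃ (a ∷ W₄) _) ⟨
    between b (b ∷ (W₃ ++ a ∷ W₄) ++ b ∷ W₅)
      ≡⟨ between-enclosed b (W₃ ++ a ∷ W₄) _ b-free ⟩
    W₃ ++ a ∷ W₄ ∎
    where
    open ≡-Reasoning
    b-free : count b (W₃ ++ a ∷ W₄) ≡ 0
    b-free = count-++-≡0 b W₃ (a ∷ W₄) (proj₂ avoids₃) (count-++-≡0 b [ a ] W₄ (count-≢ b a b≢a) (proj₂ avoids₄))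

  between-a-after : between a after ≡ []
  between-a-after with pairA
  ... | inj₁ (refl , refl) = trans (between-skip a W₁ _ (proj₁ avoids₁)) (between-adjacent a _)
  ... | inj₂ (refl , refl) =
    trans (between-skip* a _ (W₁ ∷ W₄ ∷ B₂ ∷ W₃ ∷ [])
            (proj₁ avoids₁ ∷ proj₁ avoids₄ ∷ proj₂ (AdjacentPair-avoids a a≢b pairB) ∷ proj₁ avoids₃ ∷ []))
          (between-adjacent a _)

  between-b-after : between b after ≡ []
  between-b-after with pairB
  ... | inj₁ (refl , refl) =
    trans (between-skip* b _ (W₁ ∷ A₁ ∷ W₄ ∷ W₃ ∷ A₂ ∷ W₂ ∷ [])
            (proj₂ avoids₁ ∷ proj₁ b∉A ∷ proj₂ avoids₄ ∷ proj₂ avoids₃ ∷ proj₂ b∉A ∷ proj₂ avoids₂ ∷ []))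
          (between-adjacent b _)
    where
    b∉A : count b A₁ ≡ 0 × count b A₂ ≡ 0
    b∉A = AdjacentPair-avoids b b≢a pairA
  ... | inj₂ (refl , refl) =
    trans (between-skip* b _ (W₁ ∷ A₁ ∷ W₄ ∷ [])
            (proj₂ avoids₁ ∷ proj₁ (AdjacentPair-avoids b b≢a pairA) ∷ proj₂ avoids₄ ∷ []))
          (between-adjacent b _)

  overlaps-a-b : O a b ≡ true
  overlaps-a-b rewrite a≢b | between-a-before | count-++ b W₂ (b ∷ W₃) | proj₂ avoids₂ | ≡ᵇ-refl b
    | proj₂ avoids₃ = refl

  overlaps-b-a : O b a ≡ true
  overlaps-b-a rewrite b≢a | between-b-before | count-++ a W₃ (a ∷ W₄) | proj₁ avoids₃ | ≡ᵇ-refl a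
    | proj₁ avoids₄ = refl

  overlaps-a : ∀ u → (u ≡ᵇ b) ≡ false → (u ≡ᵇ a) ≡ false → count u before ≡ 2 →
    O a u ≡ parity u W₂ xor parity u W₃
  overlaps-a u u≢b u≢a cu =
    trans (overlaps≡parity-between a u before (≡ᵇ-false-sym u a u≢a) cu)
     (trans (cong (parity u) between-a-before)
      (trans (parity-++ u W₂ (b ∷ W₃)) (cong (λ e → parity u W₂ xor (e xor parity u W₃)) u≢b)))

  overlaps-b : ∀ u → (u ≡ᵇ a) ≡ false → (u ≡ᵇ b) ≡ false → count u before ≡ 2 →
    O b u ≡ parity u W₃ xor parity u W₄
  overlaps-b u u≢a u≢b cu =
    trans (overlaps≡parity-between b u before (≡ᵇ-false-sym u b u≢b) cu)
     (trans (cong (parity u) between-b-before)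
      (trans (parity-++ u W₃ (a ∷ W₄)) (cong (λ e → parity u W₃ xor (e xor parity u W₄)) u≢a)))

  module _ (u v : ℕ) (u≢a : (u ≡ᵇ a) ≡ false) (u≢b : (u ≡ᵇ b) ≡ false)
           (v≢a : (v ≡ᵇ a) ≡ false) (v≢b : (v ≡ᵇ b) ≡ false) where

    profile-before : profile u v before ≡ profile u v (W₁ ++ W₂ ++ W₃ ++ W₄ ++ W₅)
    profile-before =
      profile-congˡ u v W₁ (trans (erase [ a ] (W₂ ++ b ∷ W₃ ++ a ∷ W₄ ++ b ∷ W₅) u∉a v∉a)
      (profile-congˡ u v W₂ (trans (erase [ b ] (W₃ ++ a ∷ W₄ ++ b ∷ W₅) u∉b v∉b)
      (profile-congˡ u v W₃ (trans (erase [ a ] (W₄ ++ b ∷ W₅) u∉a v∉a)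
      (profile-congˡ u v W₄ (erase [ b ] W₅ u∉b v∉b)))))))
      where
      erase : ∀ D Y → count u D ≡ 0 → count v D ≡ 0 → profile u v (D ++ Y) ≡ profile u v Y
      erase = profile-erase u v
      u∉a : count u [ a ] ≡ 0
      u∉a = count-≢ u a u≢a
      v∉a : count v [ a ] ≡ 0
      v∉a = count-≢ v a v≢a
      u∉b : count u [ b ] ≡ 0
      u∉b = count-≢ u b u≢b
      v∉b : count v [ b ] ≡ 0
      v∉b = count-≢ v b v≢b

    profile-after : profile u v after ≡ profile u v (W₁ ++ W₄ ++ W₃ ++ W₂ ++ W₅)
    profile-after =
      profile-congˡ u v W₁ (trans (erase A₁ (proj₁ uA) (proj₁ vA))
      (profile-congˡ u v W₄ (trans (erase B₂ (proj₂ uB) (proj₂ vB))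
      (profile-congˡ u v W₃ (trans (erase A₂ (proj₂ uA) (proj₂ vA))
      (profile-congˡ u v W₂ (erase B₁ (proj₁ uB) (proj₁ vB))))))))
      where
      erase : ∀ D {Y} → count u D ≡ 0 → count v D ≡ 0 → profile u v (D ++ Y) ≡ profile u v Y
      erase D {Y} = profile-erase u v D Y
      uA : count u A₁ ≡ 0 × count u A₂ ≡ 0
      uA = AdjacentPair-avoids u u≢a pairA
      vA : count v A₁ ≡ 0 × count v A₂ ≡ 0
      vA = AdjacentPair-avoids v v≢a pairA
      uB : count u B₁ ≡ 0 × count u B₂ ≡ 0
      uB = AdjacentPair-avoids u u≢b pairB
      vB : count v B₁ ≡ 0 × count v B₂ ≡ 0
      vB = AdjacentPair-avoids v v≢b pairB

    overlaps-after-generic : (u ≡ᵇ v) ≡ false → count u before ≡ 2 → count v before ≡ 2 →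
      overlaps u v after ≡ gcdsEdge O a b u v
    overlaps-after-generic u≢v cu cv = begin
      overlaps u v after
        ≡⟨ overlaps≡pairParity u v after u≢v (trans (count-after u) cu) (trans (count-after v) cv) ⟩
      pairParity u v after
        ≡⟨ cong proj₁ profile-after ⟩
      pairParity u v (W₁ ++ W₄ ++ W₃ ++ W₂ ++ W₅)
        ≡⟨ pairParity-swap₂₄ u v W₁ W₂ W₃ W₄ W₅ ⟩
      pairParity u v (W₁ ++ W₂ ++ W₃ ++ W₄ ++ W₅) xor defect
        ≡⟨ cong (λ t → proj₁ t xor defect) profile-before ⟨
      pairParity u v before xor defect
        ≡⟨ cong (_xor defect) (overlaps≡pairParity u v before u≢v cu cv) ⟨
      O u v xor defect
        ≡⟨ xor-comm (O u v) defect ⟩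
      defect xor O u v
        ≡⟨ cong (_xor O u v) (cong₂ _xor_ (cong₂ _∧_ (overlaps-a u u≢b u≢a cu) (overlaps-b v v≢a v≢b cv))
                                           (cong₂ _∧_ (overlaps-b u u≢a u≢b cu) (overlaps-a v v≢b v≢a cv))) ⟨
      gcdsEdge O a b u v ∎
      where
      open ≡-Reasoning
      defect : Bool
      defect = swapDefect (profile u v W₂) (profile u v W₃) (profile u v W₄)

  overlaps-after-a : ∀ v → overlaps a v after ≡ gcdsEdge O a b a v
  overlaps-after-a v rewrite overlaps-between-[] a v after between-a-after | overlaps-b-a | ≡ᵇ-refl a =
    sym (xor-same (O a v))

  overlaps-after-b : ∀ v → overlaps b v after ≡ gcdsEdge O a b b v
  overlaps-after-b v rewrite overlaps-between-[] b v after between-b-after | overlaps-a-b | ≡ᵇ-refl b =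
    sym (trans (cong (_xor O b v) (xor-identityʳ (O b v))) (xor-same (O b v)))

  overlaps-after-swap : ∀ u v → (u ≡ᵇ v) ≡ false → count u before ≡ 2 → count v before ≡ 2 →
    overlaps v u after ≡ gcdsEdge O a b v u → overlaps u v after ≡ gcdsEdge O a b u v
  overlaps-after-swap u v u≢v cu cv e =
    trans (overlaps-sym u v after u≢v (trans (count-after u) cu) (trans (count-after v) cv))
          (trans e (sym (gcdsEdge-sym O a b u v (overlaps-sym u v before u≢v cu cv))))

  overlaps-after : ∀ u v → (u ≡ᵇ v) ≡ false → count u before ≡ 2 → count v before ≡ 2 →
    overlaps u v after ≡ gcdsEdge O a b u v
  overlaps-after u v u≢v cu cv with u ≡ᵇ a in u≡a | u ≡ᵇ b in u≡b
  ... | true  | _    with refl ← ≡ᵇ-true⇒≡ u a u≡a = overlaps-after-a v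
  ... | false | true with refl ← ≡ᵇ-true⇒≡ u b u≡b = overlaps-after-b v
  ... | false | false with v ≡ᵇ a in v≡a | v ≡ᵇ b in v≡b
  ...   | true  | _    with refl ← ≡ᵇ-true⇒≡ v a v≡a = overlaps-after-swap u v u≢v cu cv (overlaps-after-a u)
  ...   | false | true with refl ← ≡ᵇ-true⇒≡ v b v≡b = overlaps-after-swap u v u≢v cu cv (overlaps-after-b u)
  ...   | false | false = overlaps-after-generic u v u≡a u≡b v≡a v≡b u≢v cu cv

-- Pointer words of framed permutations and their cuts

filterP-++ : ∀ p q X Y → filterP p q (X ++ Y) ≡ filterP p q X ++ filterP p q Y
filterP-++ p q []            Y = refl
filterP-++ p q ((i , c) ∷ X) Y with (i ≡ᵇ p) ∨ (i ≡ᵇ q)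
... | true  = cong ((i , c) ∷_) (filterP-++ p q X Y)
... | false = filterP-++ p q X Y

module PointerWord (n : ℕ) where

  leftPointer : ℕ → List ℕ
  leftPointer k = if k ≡ᵇ 0 then [] else [ k ∸ 1 ]

  rightPointer : ℕ → List ℕ
  rightPointer k = if k ≡ᵇ suc n then [] else [ k ]

  pointers : ℕ → List ℕ
  pointers k = leftPointer k ++ rightPointer k

  pointerWord : List ℕ → List ℕ
  pointerWord []       = []
  pointerWord (k ∷ ks) = pointers k ++ pointerWord ks

  pointerWord-++ : ∀ X Y → pointerWord (X ++ Y) ≡ pointerWord X ++ pointerWord Y
  pointerWord-++ []      Y = refl
  pointerWord-++ (k ∷ X) Y rewrite pointerWord-++ X Y = sym (++-assoc (pointers k) (pointerWord X) (pointerWord Y))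

  leftOcc : ℕ → ℕ → List (ℕ × ℕ)
  leftOcc k j = if k ≡ᵇ 0 then [] else [ (k ∸ 1 , j) ]

  rightOcc : ℕ → ℕ → List (ℕ × ℕ)
  rightOcc k j = if k ≡ᵇ suc n then [] else [ (k , suc j) ]

  map-proj₁-annot : ∀ j X → map proj₁ (annot n j X) ≡ pointerWord X
  map-proj₁-annot j []      = refl
  map-proj₁-annot j (k ∷ X)
    rewrite map-++ proj₁ (leftOcc k j) (rightOcc k j ++ annot n (suc j) X)
          | map-++ proj₁ (rightOcc k j) (annot n (suc j) X)
          | map-proj₁-annot (suc j) X
          = sym (trans (++-assoc (leftPointer k) (rightPointer k) (pointerWord X))
                       (cong₂ _++_ (left k) (cong (_++ pointerWord X) (right k))))
    where
    left : ∀ k → leftPointer k ≡ map proj₁ (leftOcc k j)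
    left zero    = refl
    left (suc k) = refl
    right : ∀ k → rightPointer k ≡ map proj₁ (rightOcc k j)
    right k with k ≡ᵇ suc n
    ... | true  = refl
    ... | false = refl

  ptrSeq≡pointerWord : ∀ π → ptrSeq n π ≡ pointerWord (framed n π)
  ptrSeq≡pointerWord π = map-proj₁-annot 0 (framed n π)

Last : ℕ → List ℕ → Set
Last x Y = Σ (List ℕ) λ Y′ → Y ≡ Y′ ∷ʳ x

Head : List ℕ → List ℕ → Set
Head []      Y = ⊤
Head (y ∷ _) Y = Σ (List ℕ) λ Y′ → Y ≡ suc y ∷ Y′

Head-∷ : ∀ pl k Y → Head pl [ k ] → Head pl (k ∷ Y)
Head-∷ []      k Y h        = tt
Head-∷ (y ∷ _) k Y ([] , refl) = Y , refl

-- A cut at an occurrence of x either follows the entry x (its right pointer, r = [ x ]) or precedes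
-- the entry x + 1 (its left pointer, which then opens the next block: pl′ = [ x ]).
Side : ℕ → List ℕ → List ℕ → List ℕ → Set
Side x r pl′ Y = (r ≡ [ x ] × pl′ ≡ [] × Last x Y) ⊎ (r ≡ [] × pl′ ≡ [ x ])

Side-∷ : ∀ {x r pl′ Y} k → Side x r pl′ Y → Side x r pl′ (k ∷ Y)
Side-∷ k (inj₁ (r≡ , pl≡ , (Y′ , refl))) = inj₁ (r≡ , pl≡ , (k ∷ Y′ , refl))
Side-∷ k (inj₂ s)                        = inj₂ s

Side-join : ∀ {x r pl′ Y} → Side x r pl′ Y → r ++ pl′ ≡ [ x ]
Side-join (inj₁ (refl , refl , _)) = refl
Side-join (inj₂ (refl , refl))     = refl

module Cutting (n p q : ℕ) where
  open PointerWord n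

  marked : ℕ → List ℕ → List (ℕ × ℕ)
  marked j X = filterP p q (annot n j X)

  marked-∷ : ∀ j k X {A B} → filterP p q (leftOcc k j) ≡ A → filterP p q (rightOcc k j) ≡ B →
    marked j (k ∷ X) ≡ A ++ B ++ marked (suc j) X
  marked-∷ j k X refl refl
    rewrite filterP-++ p q (leftOcc k j) (rightOcc k j ++ annot n (suc j) X)
          | filterP-++ p q (rightOcc k j) (annot n (suc j) X) = refl

  Free : List ℕ → Set
  Free = Avoids p q

  free-[] : Free []
  free-[] = refl , refl

  free-++ : ∀ X Y → Free X → Free Y → Free (X ++ Y)
  free-++ X Y (px , qx) (py , qy) = count-++-≡0 p X Y px py , count-++-≡0 q X Y qx qy

  free-single : ∀ x → ((x ≡ᵇ p) ∨ (x ≡ᵇ q)) ≡ false → Free [ x ]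
  free-single x e =
    count-≢ p x (≡ᵇ-false-sym x p (∨-conicalˡ _ _ e)) , count-≢ q x (≡ᵇ-false-sym x q (∨-conicalʳ _ _ e))

  leftStatus : ∀ k j →
    (filterP p q (leftOcc k j) ≡ [] × Free (leftPointer k)) ⊎
    (Σ ℕ λ y → k ≡ suc y × filterP p q (leftOcc k j) ≡ [ (y , j) ] × leftPointer k ≡ [ y ])
  leftStatus zero    j = inj₁ (refl , free-[])
  leftStatus (suc y) j with (y ≡ᵇ p) ∨ (y ≡ᵇ q) in e
  ... | true  = inj₂ (y , refl , refl , refl)
  ... | false = inj₁ (refl , free-single y e)

  rightStatus : ∀ k j →
    (filterP p q (rightOcc k j) ≡ [] × Free (rightPointer k)) ⊎
    (filterP p q (rightOcc k j) ≡ [ (k , suc j) ] × rightPointer k ≡ [ k ])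
  rightStatus k j with k ≡ᵇ suc n
  ... | true  = inj₁ (refl , free-[])
  ... | false with (k ≡ᵇ p) ∨ (k ≡ᵇ q) in e
  ...   | true  = inj₂ (refl , refl)
  ...   | false = inj₁ (refl , free-single k e)

  -- Cuts j pl X es: X lists the entries from position j on and es the marked pointer occurrences
  -- (with their gaps) inside X; pl = [ y ] when the previous cut was the left pointer y of the first
  -- entry of X, which is then suc y (Head pl X).
  data Cuts : ℕ → List ℕ → List ℕ → List (ℕ × ℕ) → Set where
    end : ∀ {j pl X} X₀ → pointerWord X ≡ pl ++ X₀ → Free X₀ → Head pl X → Cuts j pl X []
    cut : ∀ {j pl X x c pl′ es} Y Z Y₀ r → X ≡ Y ++ Z → length Y + j ≡ c → Free Y₀ → Head pl Y →
          pointerWord Y ≡ pl ++ Y₀ ++ r → Side x r pl′ Y → Cuts c pl′ Z es → Cuts j pl X ((x , c) ∷ es)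

  shift : ∀ {j pl k X es} K₀ → Head pl [ k ] → pointers k ≡ pl ++ K₀ → Free K₀ →
    Cuts (suc j) [] X es → Cuts j pl (k ∷ X) es
  shift {pl = pl} {k} {X} K₀ h pk fK (end X₀ wx fx _) =
    end (K₀ ++ X₀) w (free-++ K₀ X₀ fK fx) (Head-∷ pl k X h)
    where
    w : pointers k ++ pointerWord X ≡ pl ++ K₀ ++ X₀
    w rewrite pk | wx = ++-assoc pl K₀ X₀
  shift {j} {pl} {k} K₀ h pk fK (cut Y Z Y₀ r refl len fy _ wy side rest) =
    cut (k ∷ Y) Z (K₀ ++ Y₀) r refl (trans (sym (+-suc (length Y) j)) len) (free-++ K₀ Y₀ fK fy)
        (Head-∷ pl k Y h) w (Side-∷ k side) rest
    where
    w : pointers k ++ pointerWord Y ≡ pl ++ (K₀ ++ Y₀) ++ r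
    w rewrite pk | wy = trans (++-assoc pl K₀ (Y₀ ++ r)) (cong (pl ++_) (sym (++-assoc K₀ Y₀ r)))

  cuts : ∀ j X → Cuts j [] X (marked j X)
  cuts j []      = end [] refl free-[] tt
  cuts j (k ∷ X) with leftStatus k j | rightStatus k j
  ... | inj₁ (fl , freeL) | inj₁ (fr , freeR) =
    subst (Cuts j [] (k ∷ X)) (sym (marked-∷ j k X fl fr))
      (shift (pointers k) tt refl (free-++ (leftPointer k) (rightPointer k) freeL freeR) (cuts (suc j) X))
  ... | inj₁ (fl , freeL) | inj₂ (fr , rk) =
    subst (Cuts j [] (k ∷ X)) (sym (marked-∷ j k X fl fr))
      (cut [ k ] X (leftPointer k) [ k ] refl refl freeL tt w (inj₁ (refl , refl , [] , refl)) (cuts (suc j) X))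
    where
    w : pointers k ++ [] ≡ leftPointer k ++ [ k ]
    w rewrite rk = ++-identityʳ _
  ... | inj₂ (y , refl , fl , ly) | inj₁ (fr , freeR) =
    subst (Cuts j [] (suc y ∷ X)) (sym (marked-∷ j (suc y) X fl fr))
      (cut [] (suc y ∷ X) [] [] refl refl free-[] tt refl (inj₂ (refl , refl))
        (shift (rightPointer (suc y)) ([] , refl) (cong (_++ rightPointer (suc y)) ly) freeR (cuts (suc j) X)))
  ... | inj₂ (y , refl , fl , ly) | inj₂ (fr , rk) =
    subst (Cuts j [] (suc y ∷ X)) (sym (marked-∷ j (suc y) X fl fr))
      (cut [] (suc y ∷ X) [] [] refl refl free-[] tt refl (inj₂ (refl , refl))
        (cut [ suc y ] X [] [ suc y ] refl refl free-[] ([] , refl) w (inj₁ (refl , refl , [] , refl))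
          (cuts (suc j) X)))
    where
    w : pointers (suc y) ++ [] ≡ [ y ] ++ [] ++ [ suc y ]
    w rewrite ly | rk = refl

count-↭ : ∀ x {xs ys} → xs ↭ ys → count x xs ≡ count x ys
count-↭ x ↭.refl = refl
count-↭ x (↭.prep y p) with x ≡ᵇ y
... | true  = cong suc (count-↭ x p)
... | false = count-↭ x p
count-↭ x (↭.swap y z p) with x ≡ᵇ y | x ≡ᵇ z
... | true  | true  = cong (suc ∘ suc) (count-↭ x p)
... | true  | false = cong suc (count-↭ x p)
... | false | true  = cong suc (count-↭ x p)
... | false | false = count-↭ x p
count-↭ x (↭.trans p r) = trans (count-↭ x p) (count-↭ x r)

count-map-suc : ∀ x L → count (suc x) (map suc L) ≡ count x L
count-map-suc x []      = refl
count-map-suc x (y ∷ L) with x ≡ᵇ y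
... | true  = cong suc (count-map-suc x L)
... | false = count-map-suc x L

count-zero-map-suc : ∀ L → count 0 (map suc L) ≡ 0
count-zero-map-suc []      = refl
count-zero-map-suc (y ∷ L) = count-zero-map-suc L

upTo-suc : ∀ m → upTo (suc m) ≡ 0 ∷ map suc (upTo m)
upTo-suc m = cong (0 ∷_) (sym (map-upTo suc m))

count-upTo-< : ∀ {m x} → x < m → count x (upTo m) ≡ 1
count-upTo-< {suc m} {zero}  _         =
  trans (cong (count 0) (upTo-suc m)) (cong suc (count-zero-map-suc (upTo m)))
count-upTo-< {suc m} {suc x} (s≤s x<m) =
  trans (cong (count (suc x)) (upTo-suc m)) (trans (count-map-suc x (upTo m)) (count-upTo-< x<m))

count-upTo-≥ : ∀ {m x} → m ≤ x → count x (upTo m) ≡ 0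
count-upTo-≥ {zero}              _         = refl
count-upTo-≥ {suc m} {suc x} (s≤s m≤x) =
  trans (cong (count (suc x)) (upTo-suc m)) (trans (count-map-suc x (upTo m)) (count-upTo-≥ m≤x))

count-upTo-≤1 : ∀ m x → count x (upTo m) ≤ 1
count-upTo-≤1 m x with x <? m
... | yes x<m = ≤-reflexive (count-upTo-< x<m)
... | no  x≮m = subst (_≤ 1) (sym (count-upTo-≥ (≮⇒≥ x≮m))) z≤n

module FramedPermutation (n : ℕ) (π : List ℕ) (hπ : π ↭ map suc (upTo n)) where
  open PointerWord n

  F : List ℕ
  F = framed n π

  framed-↭ : F ↭ upTo (suc (suc n))
  framed-↭ = ↭-trans (↭.prep 0 (++⁺ʳ [ suc n ] hπ)) (↭-reflexive frame-upTo)
    where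
    frame-upTo : 0 ∷ map suc (upTo n) ++ [ suc n ] ≡ upTo (suc (suc n))
    frame-upTo = begin
      0 ∷ map suc (upTo n) ++ map suc [ n ] ≡⟨ cong (0 ∷_) (map-++ suc (upTo n) [ n ]) ⟨
      0 ∷ map suc (upTo n ∷ʳ n)             ≡⟨ cong (λ L → 0 ∷ map suc L) (upTo-∷ʳ n) ⟩
      0 ∷ map suc (upTo (suc n))            ≡⟨ upTo-suc (suc n) ⟨
      upTo (suc (suc n))                    ∎
      where open ≡-Reasoning

  length-F : length F ≡ suc (suc n)
  length-F = trans (↭-length framed-↭) (length-upTo (suc (suc n)))

  count-F-≤1 : ∀ x → count x F ≤ 1
  count-F-≤1 x = subst (_≤ 1) (sym (count-↭ x framed-↭)) (count-upTo-≤1 (suc (suc n)) x)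

  count-F-< : ∀ {x} → x < suc (suc n) → count x F ≡ 1
  count-F-< x<n+2 = trans (count-↭ _ framed-↭) (count-upTo-< x<n+2)

  count-pointerWord : ∀ i X → (i ≡ᵇ suc n) ≡ false → count i (pointerWord X) ≡ count (suc i) X + count i X
  count-pointerWord i []      i≢n+1 = refl
  count-pointerWord i (k ∷ X) i≢n+1 = begin
    count i (pointers k ++ pointerWord X)
      ≡⟨ count-++ i (pointers k) (pointerWord X) ⟩
    count i (leftPointer k ++ rightPointer k) + count i (pointerWord X)
      ≡⟨ cong₂ _+_ (count-++ i (leftPointer k) (rightPointer k)) (count-pointerWord i X i≢n+1) ⟩
    (count i (leftPointer k) + count i (rightPointer k)) + (count (suc i) X + count i X)
      ≡⟨ cong₂ (λ s t → (s + t) + (count (suc i) X + count i X)) (left k) right ⟩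
    (count (suc i) [ k ] + count i [ k ]) + (count (suc i) X + count i X)
      ≡⟨ interchange +-commutativeSemigroup (count (suc i) [ k ]) (count i [ k ]) _ _ ⟩
    (count (suc i) [ k ] + count (suc i) X) + (count i [ k ] + count i X)
      ≡⟨ cong₂ _+_ (count-++ (suc i) [ k ] X) (count-++ i [ k ] X) ⟨
    count (suc i) (k ∷ X) + count i (k ∷ X) ∎
    where
    open ≡-Reasoning
    left : ∀ k → count i (leftPointer k) ≡ count (suc i) [ k ]
    left zero    = refl
    left (suc k) = refl
    right : count i (rightPointer k) ≡ count i [ k ]
    right with k ≡ᵇ suc n in k≡n+1
    ... | false = refl
    ... | true rewrite ≡ᵇ-true⇒≡ k (suc n) k≡n+1 | i≢n+1 = refl

  count-pointerWord-F : ∀ i → i ≤ n → count i (pointerWord F) ≡ 2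
  count-pointerWord-F i i≤n =
    trans (count-pointerWord i F (≢⇒≡ᵇ-false (<⇒≢ (s≤s i≤n))))
          (cong₂ _+_ (count-F-< (s≤s (s≤s i≤n))) (count-F-< (s≤s (≤-trans i≤n (n≤1+n n)))))

take-length-++ : ∀ (A B : List ℕ) → take (length A) (A ++ B) ≡ A
take-length-++ []      B = refl
take-length-++ (x ∷ A) B = cong (x ∷_) (take-length-++ A B)

drop-length-++ : ∀ (A B : List ℕ) → drop (length A) (A ++ B) ≡ B
drop-length-++ []      B = refl
drop-length-++ (x ∷ A) B = drop-length-++ A B

drop-past : ∀ j Y Z (X : List ℕ) → drop j X ≡ Y ++ Z → drop (length Y + j) X ≡ Z
drop-past j Y Z X e = begin
  drop (length Y + j) X      ≡⟨ cong (λ m → drop m X) (+-comm (length Y) j) ⟩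
  drop (j + length Y) X      ≡⟨ drop-drop j (length Y) X ⟨
  drop (length Y) (drop j X) ≡⟨ cong (drop (length Y)) e ⟩
  drop (length Y) (Y ++ Z)   ≡⟨ drop-length-++ Y Z ⟩
  Z                          ∎
  where open ≡-Reasoning

slice-past : ∀ j Y Z (X : List ℕ) → drop j X ≡ Y ++ Z → slice j (length Y + j) X ≡ Y
slice-past j Y Z X e rewrite m+n∸n≡m (length Y) j | e = take-length-++ Y Z

swapBlocks-++ : ∀ Y₁ Y₂ Y₃ Y₄ Y₅ →
  let c₁ = length Y₁ + 0 ; c₂ = length Y₂ + c₁ ; c₃ = length Y₃ + c₂ ; c₄ = length Y₄ + c₃ in
  swapBlocks c₁ c₂ c₃ c₄ (Y₁ ++ Y₂ ++ Y₃ ++ Y₄ ++ Y₅) ≡ Y₁ ++ Y₄ ++ Y₃ ++ Y₂ ++ Y₅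
swapBlocks-++ Y₁ Y₂ Y₃ Y₄ Y₅ =
  cong₂ _++_ (slice-past 0 Y₁ _ X refl)
   (cong₂ _++_ (slice-past c₃ Y₄ Y₅ X d₃)
    (cong₂ _++_ (slice-past c₂ Y₃ _ X d₂)
     (cong₂ _++_ (slice-past c₁ Y₂ _ X d₁) (drop-past c₃ Y₄ Y₅ X d₃))))
  where
  X : List ℕ
  X = Y₁ ++ Y₂ ++ Y₃ ++ Y₄ ++ Y₅
  c₁ c₂ c₃ : ℕ
  c₁ = length Y₁ + 0
  c₂ = length Y₂ + c₁
  c₃ = length Y₃ + c₂
  d₁ : drop c₁ X ≡ Y₂ ++ Y₃ ++ Y₄ ++ Y₅
  d₁ = drop-past 0 Y₁ _ X refl
  d₂ : drop c₂ X ≡ Y₃ ++ Y₄ ++ Y₅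
  d₂ = drop-past c₁ Y₂ _ X d₁
  d₃ : drop c₃ X ≡ Y₄ ++ Y₅
  d₃ = drop-past c₂ Y₃ _ X d₂

module FourCutsOf (n p q : ℕ) where
  open PointerWord n
  open Cutting n p q

  record FourCuts (X : List ℕ) (a b c₁ c₂ c₃ c₄ : ℕ) : Set where
    field
      Y₁ Y₂ Y₃ Y₄ Y₅ V₁ V₂ V₃ V₄ V₅ r₁ r₂ r₃ r₄ pl₂ pl₃ pl₄ pl₅ : List ℕ
      blocks  : X ≡ Y₁ ++ Y₂ ++ Y₃ ++ Y₄ ++ Y₅
      swapped : swapBlocks c₁ c₂ c₃ c₄ X ≡ Y₁ ++ Y₄ ++ Y₃ ++ Y₂ ++ Y₅
      free₁ : Free V₁
      free₂ : Free V₂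
      free₃ : Free V₃
      free₄ : Free V₄
      free₅ : Free V₅
      word₁ : pointerWord Y₁ ≡ [] ++ V₁ ++ r₁
      word₂ : pointerWord Y₂ ≡ pl₂ ++ V₂ ++ r₂
      word₃ : pointerWord Y₃ ≡ pl₃ ++ V₃ ++ r₃
      word₄ : pointerWord Y₄ ≡ pl₄ ++ V₄ ++ r₄
      word₅ : pointerWord Y₅ ≡ pl₅ ++ V₅
      side₁ : Side a r₁ pl₂ Y₁
      side₂ : Side b r₂ pl₃ Y₂
      side₃ : Side a r₃ pl₄ Y₃
      side₄ : Side b r₄ pl₅ Y₄
      head₂ : Head pl₂ Y₂
      head₃ : Head pl₃ Y₃
      head₄ : Head pl₄ Y₄
      head₅ : Head pl₅ Y₅

  fourCuts : ∀ {X a b c₁ c₂ c₃ c₄} →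
    Cuts 0 [] X ((a , c₁) ∷ (b , c₂) ∷ (a , c₃) ∷ (b , c₄) ∷ []) → FourCuts X a b c₁ c₂ c₃ c₄
  fourCuts (cut Y₁ _ V₁ r₁ refl refl f₁ _ w₁ s₁ (cut Y₂ _ V₂ r₂ refl refl f₂ h₂ w₂ s₂
           (cut Y₃ _ V₃ r₃ refl refl f₃ h₃ w₃ s₃ (cut Y₄ Y₅ V₄ r₄ refl refl f₄ h₄ w₄ s₄
           (end V₅ w₅ f₅ h₅))))) = record
    { blocks = refl ; swapped = swapBlocks-++ Y₁ Y₂ Y₃ Y₄ Y₅
    ; free₁ = f₁ ; free₂ = f₂ ; free₃ = f₃ ; free₄ = f₄ ; free₅ = f₅
    ; word₁ = w₁ ; word₂ = w₂ ; word₃ = w₃ ; word₄ = w₄ ; word₅ = w₅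
    ; side₁ = s₁ ; side₂ = s₂ ; side₃ = s₃ ; side₄ = s₄
    ; head₂ = h₂ ; head₃ = h₃ ; head₄ = h₄ ; head₅ = h₅ }

count-last : ∀ {x Y} → Last x Y → 1 ≤ count x Y
count-last {x} (Y′ , refl) rewrite count-++ x Y′ [ x ] | ≡ᵇ-refl x = m≤n+m 1 (count x Y′)

count-head : ∀ {y Y} → Head [ y ] Y → 1 ≤ count (suc y) Y
count-head {y} (Y′ , refl) rewrite ≡ᵇ-refl y = s≤s z≤n

-- Of the two occurrences of x, one is the right pointer of the entry x and the other the left
-- pointer of x + 1; neither entry can end, respectively start, two different blocks.
adjacentPair : ∀ {x r₁ p₂ r₃ p₄ Yi Yj Yk Yl} → Side x r₁ p₂ Yi → Side x r₃ p₄ Yk → Head p₂ Yj → Head p₄ Yl →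
  (1 ≤ count x Yi → 1 ≤ count x Yk → ⊥) → (1 ≤ count (suc x) Yj → 1 ≤ count (suc x) Yl → ⊥) →
  AdjacentPair x (r₁ ++ p₄) (r₃ ++ p₂)
adjacentPair (inj₁ (refl , refl , li)) (inj₁ (refl , refl , lk)) _ _ right-twice _ =
  ⊥-elim (right-twice (count-last li) (count-last lk))
adjacentPair (inj₁ (refl , refl , _)) (inj₂ (refl , refl)) _ _ _ _ = inj₁ (refl , refl)
adjacentPair (inj₂ (refl , refl)) (inj₁ (refl , refl , _)) _ _ _ _ = inj₂ (refl , refl)
adjacentPair (inj₂ (refl , refl)) (inj₂ (refl , refl)) hj hl _ left-twice =
  ⊥-elim (left-twice (count-head hj) (count-head hl))

length-swap₂₄ : ∀ (A B C D E : List ℕ) → length (A ++ D ++ C ++ B ++ E) ≡ length (A ++ B ++ C ++ D ++ E)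
length-swap₂₄ A B C D E
  rewrite length-++ A {D ++ C ++ B ++ E} | length-++ D {C ++ B ++ E} | length-++ C {B ++ E} | length-++ B {E}
        | length-++ A {B ++ C ++ D ++ E} | length-++ B {C ++ D ++ E} | length-++ C {D ++ E} | length-++ D {E} =
  solve 5 (λ a b c d e → a :+ (d :+ (c :+ (b :+ e))) := a :+ (b :+ (c :+ (d :+ e)))) refl
    (length A) (length B) (length C) (length D) (length E)
  where open Data.Nat.Solver.+-*-Solver using (solve; _:+_; _:=_)

unframe-framed : ∀ n M → length M ≡ n → framed n (unframe n (0 ∷ M ++ [ suc n ])) ≡ 0 ∷ M ++ [ suc n ]
unframe-framed n M refl = cong (λ K → 0 ∷ K ++ [ suc n ]) (take-length-++ M [ suc n ])

first-entry : ∀ {n a V₁ r₁ pl₂} T Y₁ Y₂ R → 0 ∷ T ≡ Y₁ ++ Y₂ ++ R →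
  PointerWord.pointerWord n Y₁ ≡ [] ++ V₁ ++ r₁ →
  Side a r₁ pl₂ Y₁ → Head pl₂ Y₂ → Σ (List ℕ) λ Y₁′ → Y₁ ≡ 0 ∷ Y₁′
first-entry {V₁ = V₁} T [] Y₂ R e w (inj₁ (refl , _)) _ with () ← ++-conicalʳ V₁ _ (sym w)
first-entry T []         Y₂ R () w (inj₂ (refl , refl)) (Y′ , refl)
first-entry T (y ∷ Y₁′) Y₂ R e  _ _                      _          = Y₁′ , cong (_∷ Y₁′) (sym (∷-injectiveˡ e))

last-entry : ∀ {n b r₄ pl₅ V₅} L P Y₄ Y₅ → P ++ Y₄ ++ Y₅ ≡ L ∷ʳ suc n →
  PointerWord.pointerWord n Y₅ ≡ pl₅ ++ V₅ →
  Side b r₄ pl₅ Y₄ → b ≤ n → Σ (List ℕ) λ I → Y₅ ≡ I ∷ʳ suc n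
last-entry L P Y₄ Y₅ e w side b≤n with initLast Y₅
last-entry {n} {b} L P _ _ e () (inj₂ (refl , refl)) b≤n | []
last-entry {n} {b} L P _ _ e w (inj₁ (refl , refl , Y′ , refl)) b≤n | [] =
  contradiction (proj₂ (∷ʳ-injective (P ++ Y′) L (trans (reassoc P Y′) e))) (<⇒≢ (s≤s b≤n))
  where
  reassoc : ∀ P Y′ → (P ++ Y′) ∷ʳ b ≡ P ++ (Y′ ∷ʳ b) ++ []
  reassoc P Y′ = solve 3 (λ P Y′ B → (P ⊕ Y′) ⊕ B ⊜ P ⊕ (Y′ ⊕ B) ⊕ id) refl P Y′ [ b ]
    where open ++-Solver using (solve; _⊕_; _⊜_; id)
last-entry {n} L P Y₄ _ e w side b≤n | I ∷ʳ′ l =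
  I , cong (I ∷ʳ_) (proj₂ (∷ʳ-injective (P ++ Y₄ ++ I) L (trans (reassoc P Y₄ I) e)))
  where
  reassoc : ∀ P Y₄ I → (P ++ Y₄ ++ I) ∷ʳ l ≡ P ++ Y₄ ++ I ∷ʳ l
  reassoc P Y₄ I = solve 4 (λ P Y₄ I L → (P ⊕ Y₄ ⊕ I) ⊕ L ⊜ P ⊕ Y₄ ⊕ I ⊕ L) refl P Y₄ I [ l ]
    where open ++-Solver using (solve; _⊕_; _⊜_)

module SwapOfFramed (n : ℕ) (π : List ℕ) (hπ : π ↭ map suc (upTo n)) (p q : ℕ) where
  open PointerWord n
  open FramedPermutation n π hπ
  open Cutting n p q
  open FourCutsOf n p q

  occurs-twice⇒⊥ : ∀ x P A B C R → F ≡ P ++ A ++ B ++ C ++ R → 1 ≤ count x A → 1 ≤ count x C → ⊥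
  occurs-twice⇒⊥ x P A B C R F≡ 1≤a 1≤c = contradiction (≤-trans two ≤1) λ { (s≤s ()) }
    where
    ≤1 : count x P + (count x A + (count x B + (count x C + count x R))) ≤ 1
    ≤1 = subst (_≤ 1) (count-++₅ x P A B C R) (subst (λ L → count x L ≤ 1) F≡ (count-F-≤1 x))
    two : 2 ≤ count x P + (count x A + (count x B + (count x C + count x R)))
    two = ≤-trans (+-mono-≤ 1≤a 1≤c)
            (≤-trans (+-monoʳ-≤ (count x A) (≤-trans (m≤m+n (count x C) (count x R)) (m≤n+m _ (count x B))))
                     (m≤n+m _ (count x P)))

  private
    group-first-three : ∀ (A B C D E : List ℕ) → A ++ B ++ C ++ D ++ E ≡ (A ++ B ++ C) ++ D ++ E
    group-first-three = solve 5 (λ A B C D E → A ⊕ B ⊕ C ⊕ D ⊕ E ⊜ (A ⊕ B ⊕ C) ⊕ D ⊕ E) refl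
      where open ++-Solver using (solve; _⊕_; _⊜_)

    framed-shape : ∀ A B C D I → (0 ∷ A) ++ B ++ C ++ D ++ I ∷ʳ suc n ≡ 0 ∷ (A ++ B ++ C ++ D ++ I) ++ [ suc n ]
    framed-shape A B C D I = cong (0 ∷_) (solve 6 (λ A B C D I N → A ⊕ B ⊕ C ⊕ D ⊕ I ⊕ N ⊜ (A ⊕ B ⊕ C ⊕ D ⊕ I) ⊕ N) refl
                                     A B C D I [ suc n ])
      where open ++-Solver using (solve; _⊕_; _⊜_)

  module _ {a b c₁ c₂ c₃ c₄ : ℕ} (fc : FourCuts F a b c₁ c₂ c₃ c₄) where
    open FourCuts fc

    pairA : AdjacentPair a (r₁ ++ pl₄) (r₃ ++ pl₂)
    pairA = adjacentPair side₁ side₃ head₂ head₄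
      (occurs-twice⇒⊥ a [] Y₁ Y₂ Y₃ (Y₄ ++ Y₅) blocks) (occurs-twice⇒⊥ (suc a) Y₁ Y₂ Y₃ Y₄ Y₅ blocks)

    pairB : AdjacentPair b (r₂ ++ pl₅) (r₄ ++ pl₃)
    pairB = adjacentPair side₂ side₄ head₃ head₅
      (occurs-twice⇒⊥ b Y₁ Y₂ Y₃ Y₄ Y₅ blocks) (occurs-twice⇒⊥ (suc b) (Y₁ ++ Y₂) Y₃ Y₄ Y₅ [] blocks′)
      where
      blocks′ : F ≡ (Y₁ ++ Y₂) ++ Y₃ ++ Y₄ ++ Y₅ ++ []
      blocks′ = trans blocks (solve 5 (λ A B C D E → A ⊕ B ⊕ C ⊕ D ⊕ E ⊜ (A ⊕ B) ⊕ C ⊕ D ⊕ E ⊕ id) refl Y₁ Y₂ Y₃ Y₄ Y₅)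
        where open ++-Solver using (solve; _⊕_; _⊜_; id)

    pointerWord-blocks : ∀ A B C D E → pointerWord (A ++ B ++ C ++ D ++ E) ≡
      pointerWord A ++ pointerWord B ++ pointerWord C ++ pointerWord D ++ pointerWord E
    pointerWord-blocks A B C D E
      rewrite pointerWord-++ A (B ++ C ++ D ++ E) | pointerWord-++ B (C ++ D ++ E)
            | pointerWord-++ C (D ++ E) | pointerWord-++ D E = refl

    regroup : ∀ (V₁ r₁ p₂ V₂ r₂ p₃ V₃ r₃ p₄ V₄ r₄ p₅ V₅ : List ℕ) →
      ([] ++ V₁ ++ r₁) ++ (p₂ ++ V₂ ++ r₂) ++ (p₃ ++ V₃ ++ r₃) ++ (p₄ ++ V₄ ++ r₄) ++ (p₅ ++ V₅) ≡
      V₁ ++ (r₁ ++ p₂) ++ V₂ ++ (r₂ ++ p₃) ++ V₃ ++ (r₃ ++ p₄) ++ V₄ ++ (r₄ ++ p₅) ++ V₅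
    regroup = solve 13 (λ V₁ r₁ p₂ V₂ r₂ p₃ V₃ r₃ p₄ V₄ r₄ p₅ V₅ →
      (id ⊕ V₁ ⊕ r₁) ⊕ (p₂ ⊕ V₂ ⊕ r₂) ⊕ (p₃ ⊕ V₃ ⊕ r₃) ⊕ (p₄ ⊕ V₄ ⊕ r₄) ⊕ (p₅ ⊕ V₅) ⊜
      V₁ ⊕ (r₁ ⊕ p₂) ⊕ V₂ ⊕ (r₂ ⊕ p₃) ⊕ V₃ ⊕ (r₃ ⊕ p₄) ⊕ V₄ ⊕ (r₄ ⊕ p₅) ⊕ V₅) refl
      where open ++-Solver using (solve; _⊕_; _⊜_; id)

    word-before : pointerWord F ≡ V₁ ++ a ∷ V₂ ++ b ∷ V₃ ++ a ∷ V₄ ++ b ∷ V₅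
    word-before = begin
      pointerWord F
        ≡⟨ cong pointerWord blocks ⟩
      pointerWord (Y₁ ++ Y₂ ++ Y₃ ++ Y₄ ++ Y₅)
        ≡⟨ pointerWord-blocks Y₁ Y₂ Y₃ Y₄ Y₅ ⟩
      pointerWord Y₁ ++ pointerWord Y₂ ++ pointerWord Y₃ ++ pointerWord Y₄ ++ pointerWord Y₅
        ≡⟨ cong₂ _++_ word₁ (cong₂ _++_ word₂ (cong₂ _++_ word₃ (cong₂ _++_ word₄ word₅))) ⟩
      ([] ++ V₁ ++ r₁) ++ (pl₂ ++ V₂ ++ r₂) ++ (pl₃ ++ V₃ ++ r₃) ++ (pl₄ ++ V₄ ++ r₄) ++ (pl₅ ++ V₅)
        ≡⟨ regroup V₁ r₁ pl₂ V₂ r₂ pl₃ V₃ r₃ pl₄ V₄ r₄ pl₅ V₅ ⟩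
      V₁ ++ (r₁ ++ pl₂) ++ V₂ ++ (r₂ ++ pl₃) ++ V₃ ++ (r₃ ++ pl₄) ++ V₄ ++ (r₄ ++ pl₅) ++ V₅
        ≡⟨ cong₂ (λ s t → V₁ ++ s ++ V₂ ++ t) (Side-join side₁)
                 (cong₂ (λ s t → s ++ V₃ ++ t) (Side-join side₂)
                        (cong₂ (λ s t → s ++ V₄ ++ t ++ V₅) (Side-join side₃) (Side-join side₄))) ⟩
      V₁ ++ a ∷ V₂ ++ b ∷ V₃ ++ a ∷ V₄ ++ b ∷ V₅ ∎
      where open ≡-Reasoning

    word-swapped : pointerWord (Y₁ ++ Y₄ ++ Y₃ ++ Y₂ ++ Y₅) ≡
      V₁ ++ (r₁ ++ pl₄) ++ V₄ ++ (r₄ ++ pl₃) ++ V₃ ++ (r₃ ++ pl₂) ++ V₂ ++ (r₂ ++ pl₅) ++ V₅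
    word-swapped = begin
      pointerWord (Y₁ ++ Y₄ ++ Y₃ ++ Y₂ ++ Y₅)
        ≡⟨ pointerWord-blocks Y₁ Y₄ Y₃ Y₂ Y₅ ⟩
      pointerWord Y₁ ++ pointerWord Y₄ ++ pointerWord Y₃ ++ pointerWord Y₂ ++ pointerWord Y₅
        ≡⟨ cong₂ _++_ word₁ (cong₂ _++_ word₄ (cong₂ _++_ word₃ (cong₂ _++_ word₂ word₅))) ⟩
      ([] ++ V₁ ++ r₁) ++ (pl₄ ++ V₄ ++ r₄) ++ (pl₃ ++ V₃ ++ r₃) ++ (pl₂ ++ V₂ ++ r₂) ++ (pl₅ ++ V₅)
        ≡⟨ regroup V₁ r₁ pl₄ V₄ r₄ pl₃ V₃ r₃ pl₂ V₂ r₂ pl₅ V₅ ⟩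
      V₁ ++ (r₁ ++ pl₄) ++ V₄ ++ (r₄ ++ pl₃) ++ V₃ ++ (r₃ ++ pl₂) ++ V₂ ++ (r₂ ++ pl₅) ++ V₅ ∎
      where open ≡-Reasoning

    reframed : b ≤ n → framed n (unframe n (swapBlocks c₁ c₂ c₃ c₄ F)) ≡ Y₁ ++ Y₄ ++ Y₃ ++ Y₂ ++ Y₅
    reframed b≤n with first-entry (π ++ [ suc n ]) Y₁ Y₂ (Y₃ ++ Y₄ ++ Y₅) blocks word₁ side₁ head₂
                   | last-entry (0 ∷ π) (Y₁ ++ Y₂ ++ Y₃) Y₄ Y₅ (sym (trans blocks (group-first-three Y₁ Y₂ Y₃ Y₄ Y₅)))
                                word₅ side₄ b≤n
    ... | Y₁′ , refl | I , refl =
      trans (cong (framed n ∘ unframe n) (trans swapped (framed-shape Y₁′ Y₄ Y₃ Y₂ I)))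
            (trans (unframe-framed n (Y₁′ ++ Y₄ ++ Y₃ ++ Y₂ ++ I) length-M′) (sym (framed-shape Y₁′ Y₄ Y₃ Y₂ I)))
      where
      M : List ℕ
      M = Y₁′ ++ Y₂ ++ Y₃ ++ Y₄ ++ I
      length-M : length M ≡ n
      length-M = suc-injective (suc-injective (begin
        suc (suc (length M))          ≡⟨ cong suc (+-comm 1 (length M)) ⟩
        suc (length M + 1)            ≡⟨ cong suc (length-++ M) ⟨
        length (0 ∷ M ++ [ suc n ])   ≡⟨ cong length (trans blocks (framed-shape Y₁′ Y₂ Y₃ Y₄ I)) ⟨
        length F                      ≡⟨ length-F ⟩
        suc (suc n)                   ∎))
        where open ≡-Reasoning
      length-M′ : length (Y₁′ ++ Y₄ ++ Y₃ ++ Y₂ ++ I) ≡ n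
      length-M′ = trans (length-swap₂₄ Y₁′ Y₂ Y₃ Y₄ I) length-M

  record SwapWitness (π′ : List ℕ) : Set where
    field
      a b        : ℕ
      roles      : (a ≡ p × b ≡ q) ⊎ (a ≡ q × b ≡ p)
      doubleSwap : DoubleSwap a b
      ptrSeq-π   : ptrSeq n π ≡ DoubleSwap.before doubleSwap
      ptrSeq-π′  : ptrSeq n π′ ≡ DoubleSwap.after doubleSwap

  swapWitness : ∀ {a b c₁ c₂ c₃ c₄} → (a ≡ p × b ≡ q) ⊎ (a ≡ q × b ≡ p) → (a ≡ᵇ b) ≡ false → b ≤ n →
    marked 0 F ≡ (a , c₁) ∷ (b , c₂) ∷ (a , c₃) ∷ (b , c₄) ∷ [] →
    SwapWitness (unframe n (swapBlocks c₁ c₂ c₃ c₄ F))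
  swapWitness {a} {b} {c₁} {c₂} {c₃} {c₄} roles a≢b b≤n marks = record
    { a = a ; b = b ; roles = roles ; doubleSwap = doubleSwap
    ; ptrSeq-π  = trans (ptrSeq≡pointerWord π) (word-before fc)
    ; ptrSeq-π′ = trans (ptrSeq≡pointerWord (unframe n (swapBlocks c₁ c₂ c₃ c₄ F)))
                        (trans (cong pointerWord (reframed fc b≤n)) (word-swapped fc)) }
    where
    fc : FourCuts F a b c₁ c₂ c₃ c₄
    fc = fourCuts (subst (Cuts 0 [] F) marks (cuts 0 F))
    open FourCuts fc
    avoids : ∀ X → Free X → Avoids a b X
    avoids X = Avoids-roles {p = p} {q} {X} roles
    doubleSwap : DoubleSwap a b
    doubleSwap = record
      { W₁ = V₁ ; W₂ = V₂ ; W₃ = V₃ ; W₄ = V₄ ; W₅ = V₅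
      ; A₁ = r₁ ++ pl₄ ; A₂ = r₃ ++ pl₂ ; B₁ = r₂ ++ pl₅ ; B₂ = r₄ ++ pl₃
      ; a≢b = a≢b
      ; avoids₁ = avoids V₁ free₁ ; avoids₂ = avoids V₂ free₂ ; avoids₃ = avoids V₃ free₃
      ; avoids₄ = avoids V₄ free₄ ; avoids₅ = avoids V₅ free₅
      ; pairA = pairA fc ; pairB = pairB fc }

  cds-condition : ∀ a₁ a₂ a₃ a₄ →
    (nonRoot n p ∧ nonRoot n q ∧ not (p ≡ᵇ q) ∧
      (((a₁ ≡ᵇ p) ∧ (a₂ ≡ᵇ q) ∧ (a₃ ≡ᵇ p) ∧ (a₄ ≡ᵇ q)) ∨ ((a₁ ≡ᵇ q) ∧ (a₂ ≡ᵇ p) ∧ (a₃ ≡ᵇ q) ∧ (a₄ ≡ᵇ p)))) ≡ true →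
    (p ≡ᵇ q) ≡ false × ((a₁ ≡ p × a₂ ≡ q × a₃ ≡ p × a₄ ≡ q) ⊎ (a₁ ≡ q × a₂ ≡ p × a₃ ≡ q × a₄ ≡ p))
  cds-condition a₁ a₂ a₃ a₄ holds =
    not-true (p ≡ᵇ q) (∧-conicalˡ (not (p ≡ᵇ q)) alternating distinct-and-alternating) ,
    map-⊎ (all-≡ᵇ⇒≡ a₁ p a₂ q a₃ p a₄ q) (all-≡ᵇ⇒≡ a₁ q a₂ p a₃ q a₄ p)
          (∨-true _ _ (∧-conicalʳ (not (p ≡ᵇ q)) alternating distinct-and-alternating))
    where
    alternating : Bool
    alternating = ((a₁ ≡ᵇ p) ∧ (a₂ ≡ᵇ q) ∧ (a₃ ≡ᵇ p) ∧ (a₄ ≡ᵇ q)) ∨ ((a₁ ≡ᵇ q) ∧ (a₂ ≡ᵇ p) ∧ (a₃ ≡ᵇ q) ∧ (a₄ ≡ᵇ p))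
    distinct-and-alternating : (not (p ≡ᵇ q) ∧ alternating) ≡ true
    distinct-and-alternating = ∧-conicalʳ (nonRoot n q) _ (∧-conicalʳ (nonRoot n p) _ holds)

  cds⇒swapWitness : ∀ {π′} → p < n → q < n → cds n π p q ≡ just π′ → SwapWitness π′
  cds⇒swapWitness p<n q<n h with marked 0 F in marks
  ... | (a₁ , c₁) ∷ (a₂ , c₂) ∷ (a₃ , c₃) ∷ (a₄ , c₄) ∷ [] with if-just h
  ...   | holds , refl with cds-condition a₁ a₂ a₃ a₄ holds
  ...     | p≢q , inj₁ (refl , refl , refl , refl) =
    swapWitness (inj₁ (refl , refl)) p≢q (<⇒≤ q<n) marks
  ...     | p≢q , inj₂ (refl , refl , refl , refl) =
    swapWitness (inj₂ (refl , refl)) (≡ᵇ-false-sym p q p≢q) (<⇒≤ p<n) marks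
  cds⇒swapWitness p<n q<n h | []                        with () ← h
  cds⇒swapWitness p<n q<n h | _ ∷ []                    with () ← h
  cds⇒swapWitness p<n q<n h | _ ∷ _ ∷ []                with () ← h
  cds⇒swapWitness p<n q<n h | _ ∷ _ ∷ _ ∷ []            with () ← h
  cds⇒swapWitness p<n q<n h | _ ∷ _ ∷ _ ∷ _ ∷ _ ∷ _     with () ← h

  cds⇒overlaps : ∀ {π′} → p < n → q < n → cds n π p q ≡ just π′ → overlaps p q (ptrSeq n π) ≡ true
  cds⇒overlaps p<n q<n h with cds⇒swapWitness p<n q<n h
  ... | record { roles = inj₁ (refl , refl) ; doubleSwap = s ; ptrSeq-π = eq } =
    trans (cong (overlaps p q) eq) (DoubleSwapProperties.overlaps-a-b s)
  ... | record { roles = inj₂ (refl , refl) ; doubleSwap = s ; ptrSeq-π = eq } =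
    trans (cong (overlaps p q) eq) (DoubleSwapProperties.overlaps-b-a s)

  cds⇒graph : ∀ {π′} → p < n → q < n → cds n π p q ≡ just π′ → ∀ u v →
    OG n π′ u v ≡ (if toℕ u ≡ᵇ toℕ v then false else
                   gcdsEdge (λ x y → overlaps x y (ptrSeq n π)) p q (toℕ u) (toℕ v))
  cds⇒graph {π′} p<n q<n h u v = if-else-cong (toℕ u ≡ᵇ toℕ v) λ u≢v →
    trans (sym (overlaps-≢ U V (ptrSeq n π′) u≢v)) (edges u≢v (cds⇒swapWitness p<n q<n h))
    where
    U V : ℕ
    U = toℕ u
    V = toℕ v
    counts : ∀ x → x ≤ n → count x (ptrSeq n π) ≡ 2
    counts x x≤n = trans (cong (count x) (ptrSeq≡pointerWord π)) (count-pointerWord-F x x≤n)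
    edges : (U ≡ᵇ V) ≡ false → SwapWitness π′ →
      overlaps U V (ptrSeq n π′) ≡ gcdsEdge (λ x y → overlaps x y (ptrSeq n π)) p q U V
    edges u≢v record { a = a ; b = b ; roles = roles ; doubleSwap = s ; ptrSeq-π = eq ; ptrSeq-π′ = eq′ } = begin
      overlaps U V (ptrSeq n π′)
        ≡⟨ cong (overlaps U V) eq′ ⟩
      overlaps U V after
        ≡⟨ overlaps-after U V u≢v (before-count U (toℕ<n u)) (before-count V (toℕ<n v)) ⟩
      gcdsEdge (λ x y → overlaps x y before) a b U V
        ≡⟨ cong (λ w → gcdsEdge (λ x y → overlaps x y w) a b U V) eq ⟨
      gcdsEdge (λ x y → overlaps x y (ptrSeq n π)) a b U V
        ≡⟨ gcdsEdge-roles {O = λ x y → overlaps x y (ptrSeq n π)} {u = U} {V} roles ⟩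
      gcdsEdge (λ x y → overlaps x y (ptrSeq n π)) p q U V ∎
      where
      open ≡-Reasoning
      open DoubleSwap s using (before; after)
      open DoubleSwapProperties s using (overlaps-after)
      before-count : ∀ x → x < suc n → count x before ≡ 2
      before-count x x<n+1 = trans (cong (count x) (sym eq)) (counts x (≤-pred x<n+1))

-- cds is defined exactly on overlapping pairs

onlyPQ : ℕ → ℕ → List ℕ → List ℕ
onlyPQ p q []       = []
onlyPQ p q (x ∷ xs) = if (x ≡ᵇ p) ∨ (x ≡ᵇ q) then x ∷ onlyPQ p q xs else onlyPQ p q xs

map-proj₁-filterP : ∀ p q A → map proj₁ (filterP p q A) ≡ onlyPQ p q (map proj₁ A)
map-proj₁-filterP p q []            = refl
map-proj₁-filterP p q ((i , c) ∷ A) with (i ≡ᵇ p) ∨ (i ≡ᵇ q)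
... | true  = cong (i ∷_) (map-proj₁-filterP p q A)
... | false = map-proj₁-filterP p q A

Bit : ℕ → Set
Bit k = k ≡ 0 ⊎ k ≡ 1

length-bits : ∀ {K} → All Bit K → length K ≡ count 0 K + count 1 K
length-bits []                = refl
length-bits (inj₁ refl ∷ bits) = cong suc (length-bits bits)
length-bits {_ ∷ K} (inj₂ refl ∷ bits) = trans (cong suc (length-bits bits)) (sym (+-suc (count 0 K) (count 1 K)))

alternating-bits : ∀ {k₁ k₂ k₃ k₄} → All Bit (k₁ ∷ k₂ ∷ k₃ ∷ k₄ ∷ []) →
  let K = k₁ ∷ k₂ ∷ k₃ ∷ k₄ ∷ [] in count 0 K ≡ 2 → count 1 K ≡ 2 → count 1 (between 0 K) ≡ 1 →
  (k₁ ≡ 0 × k₂ ≡ 1 × k₃ ≡ 0 × k₄ ≡ 1) ⊎ (k₁ ≡ 1 × k₂ ≡ 0 × k₃ ≡ 1 × k₄ ≡ 0)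
alternating-bits (inj₁ refl ∷ inj₁ refl ∷ inj₁ refl ∷ inj₁ refl ∷ []) ()   _    _
alternating-bits (inj₁ refl ∷ inj₁ refl ∷ inj₁ refl ∷ inj₂ refl ∷ []) ()   _    _
alternating-bits (inj₁ refl ∷ inj₁ refl ∷ inj₂ refl ∷ inj₁ refl ∷ []) ()   _    _
alternating-bits (inj₁ refl ∷ inj₁ refl ∷ inj₂ refl ∷ inj₂ refl ∷ []) _    _    ()
alternating-bits (inj₁ refl ∷ inj₂ refl ∷ inj₁ refl ∷ inj₁ refl ∷ []) ()   _    _
alternating-bits (inj₁ refl ∷ inj₂ refl ∷ inj₁ refl ∷ inj₂ refl ∷ []) _    _    _  = inj₁ (refl , refl , refl , refl)
alternating-bits (inj₁ refl ∷ inj₂ refl ∷ inj₂ refl ∷ inj₁ refl ∷ []) _    _    ()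
alternating-bits (inj₁ refl ∷ inj₂ refl ∷ inj₂ refl ∷ inj₂ refl ∷ []) ()   _    _
alternating-bits (inj₂ refl ∷ inj₁ refl ∷ inj₁ refl ∷ inj₁ refl ∷ []) ()   _    _
alternating-bits (inj₂ refl ∷ inj₁ refl ∷ inj₁ refl ∷ inj₂ refl ∷ []) _    _    ()
alternating-bits (inj₂ refl ∷ inj₁ refl ∷ inj₂ refl ∷ inj₁ refl ∷ []) _    _    _  = inj₂ (refl , refl , refl , refl)
alternating-bits (inj₂ refl ∷ inj₁ refl ∷ inj₂ refl ∷ inj₂ refl ∷ []) ()   _    _
alternating-bits (inj₂ refl ∷ inj₂ refl ∷ inj₁ refl ∷ inj₁ refl ∷ []) _    _    ()
alternating-bits (inj₂ refl ∷ inj₂ refl ∷ inj₁ refl ∷ inj₂ refl ∷ []) ()   _    _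
alternating-bits (inj₂ refl ∷ inj₂ refl ∷ inj₂ refl ∷ inj₁ refl ∷ []) ()   _    _
alternating-bits (inj₂ refl ∷ inj₂ refl ∷ inj₂ refl ∷ inj₂ refl ∷ []) ()   _    _

module CdsDefinedness (p q : ℕ) (p≢q : (p ≡ᵇ q) ≡ false) where

  PQ : ℕ → Set
  PQ x = x ≡ p ⊎ x ≡ q

  keep-PQ : ∀ x → ((x ≡ᵇ p) ∨ (x ≡ᵇ q)) ≡ true → PQ x
  keep-PQ x e with x ≡ᵇ p in x≡p
  ... | true  = inj₁ (≡ᵇ-true⇒≡ x p x≡p)
  ... | false = inj₂ (≡ᵇ-true⇒≡ x q e)

  drop-≢ : ∀ {u} x → PQ u → ((x ≡ᵇ p) ∨ (x ≡ᵇ q)) ≡ false → (u ≡ᵇ x) ≡ false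
  drop-≢ x (inj₁ refl) e = ≡ᵇ-false-sym x p (∨-conicalˡ _ _ e)
  drop-≢ x (inj₂ refl) e = ≡ᵇ-false-sym x q (∨-conicalʳ _ _ e)

  onlyPQ-PQ : ∀ L → All PQ (onlyPQ p q L)
  onlyPQ-PQ []      = []
  onlyPQ-PQ (x ∷ L) with (x ≡ᵇ p) ∨ (x ≡ᵇ q) in e
  ... | true  = keep-PQ x e ∷ onlyPQ-PQ L
  ... | false = onlyPQ-PQ L

  count-onlyPQ : ∀ u → PQ u → ∀ L → count u (onlyPQ p q L) ≡ count u L
  count-onlyPQ u u∈ []      = refl
  count-onlyPQ u u∈ (x ∷ L) with (x ≡ᵇ p) ∨ (x ≡ᵇ q) in e
  ... | true with u ≡ᵇ x
  ...   | true  = cong suc (count-onlyPQ u u∈ L)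
  ...   | false = count-onlyPQ u u∈ L
  count-onlyPQ u u∈ (x ∷ L) | false rewrite drop-≢ x u∈ e = count-onlyPQ u u∈ L

  between-onlyPQ : ∀ L → between p (onlyPQ p q L) ≡ onlyPQ p q (between p L)
  between-onlyPQ L = trans (cong (beforeFirst p) (afterFirst-onlyPQ L)) (beforeFirst-onlyPQ (afterFirst p L))
    where
    afterFirst-onlyPQ : ∀ L → afterFirst p (onlyPQ p q L) ≡ onlyPQ p q (afterFirst p L)
    afterFirst-onlyPQ []      = refl
    afterFirst-onlyPQ (x ∷ L) with (x ≡ᵇ p) ∨ (x ≡ᵇ q) in e
    ... | true with p ≡ᵇ x
    ...   | true  = refl
    ...   | false = afterFirst-onlyPQ L
    afterFirst-onlyPQ (x ∷ L) | false rewrite drop-≢ x (inj₁ refl) e = afterFirst-onlyPQ L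
    beforeFirst-onlyPQ : ∀ L → beforeFirst p (onlyPQ p q L) ≡ onlyPQ p q (beforeFirst p L)
    beforeFirst-onlyPQ []      = refl
    beforeFirst-onlyPQ (x ∷ L) with (x ≡ᵇ p) ∨ (x ≡ᵇ q) in e
    ... | true with p ≡ᵇ x
    ...   | true  = refl
    ...   | false rewrite e = cong (x ∷_) (beforeFirst-onlyPQ L)
    beforeFirst-onlyPQ (x ∷ L) | false rewrite drop-≢ x (inj₁ refl) e | e = beforeFirst-onlyPQ L

  bit : ℕ → ℕ
  bit x = if x ≡ᵇ p then 0 else 1

  bit-≡ᵇ : ∀ {u x} → PQ u → PQ x → (u ≡ᵇ x) ≡ (bit u ≡ᵇ bit x)
  bit-≡ᵇ (inj₁ refl) (inj₁ refl) rewrite ≡ᵇ-refl p = refl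
  bit-≡ᵇ (inj₁ refl) (inj₂ refl) rewrite ≡ᵇ-refl p | ≡ᵇ-false-sym p q p≢q | p≢q = refl
  bit-≡ᵇ (inj₂ refl) (inj₁ refl) rewrite ≡ᵇ-refl p | ≡ᵇ-false-sym p q p≢q = refl
  bit-≡ᵇ (inj₂ refl) (inj₂ refl) rewrite ≡ᵇ-refl q | ≡ᵇ-false-sym p q p≢q = refl

  bit-Bit : ∀ x → Bit (bit x)
  bit-Bit x with x ≡ᵇ p
  ... | true  = inj₁ refl
  ... | false = inj₂ refl

  bit-decode : ∀ {x} → PQ x → (bit x ≡ 0 → x ≡ p) × (bit x ≡ 1 → x ≡ q)
  bit-decode (inj₁ refl) = (λ _ → refl) , λ e → ⊥-elim (0≢1 (trans (sym (bit-p)) e))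
    where
    bit-p : bit p ≡ 0
    bit-p rewrite ≡ᵇ-refl p = refl
    0≢1 : 0 ≢ 1
    0≢1 ()
  bit-decode (inj₂ refl) = (λ e → ⊥-elim (1≢0 (trans (sym bit-q) e))) , λ _ → refl
    where
    bit-q : bit q ≡ 1
    bit-q rewrite ≡ᵇ-false-sym p q p≢q = refl
    1≢0 : 1 ≢ 0
    1≢0 ()

  bit-p : bit p ≡ 0
  bit-p rewrite ≡ᵇ-refl p = refl

  bit-q : bit q ≡ 1
  bit-q rewrite ≡ᵇ-false-sym p q p≢q = refl

  count-bits : ∀ {u} → PQ u → ∀ {L} → All PQ L → count u L ≡ count (bit u) (map bit L)
  count-bits u∈ []              = refl
  count-bits {u} u∈ {x ∷ L} (x∈ ∷ L∈) rewrite bit-≡ᵇ u∈ x∈ with bit u ≡ᵇ bit x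
  ... | true  = cong suc (count-bits u∈ L∈)
  ... | false = count-bits u∈ L∈

  p≡ᵇ⇒0≡ᵇbit : ∀ {x} → PQ x → (p ≡ᵇ x) ≡ (0 ≡ᵇ bit x)
  p≡ᵇ⇒0≡ᵇbit {x} x∈ = trans (bit-≡ᵇ (inj₁ refl) x∈) (cong (_≡ᵇ bit x) bit-p)

  afterFirst-bits : ∀ {L} → All PQ L → afterFirst 0 (map bit L) ≡ map bit (afterFirst p L)
  afterFirst-bits []                    = refl
  afterFirst-bits {x ∷ L} (x∈ ∷ L∈) rewrite p≡ᵇ⇒0≡ᵇbit x∈ with 0 ≡ᵇ bit x
  ... | true  = refl
  ... | false = afterFirst-bits L∈

  beforeFirst-bits : ∀ {L} → All PQ L → beforeFirst 0 (map bit L) ≡ map bit (beforeFirst p L)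
  beforeFirst-bits []                    = refl
  beforeFirst-bits {x ∷ L} (x∈ ∷ L∈) rewrite p≡ᵇ⇒0≡ᵇbit x∈ with 0 ≡ᵇ bit x
  ... | true  = refl
  ... | false = cong (bit x ∷_) (beforeFirst-bits L∈)

  All-afterFirst : ∀ {P : ℕ → Set} u {L} → All P L → All P (afterFirst u L)
  All-afterFirst u []                  = []
  All-afterFirst u {x ∷ L} (px ∷ pL) with u ≡ᵇ x
  ... | true  = pL
  ... | false = All-afterFirst u pL

  All-beforeFirst : ∀ {P : ℕ → Set} u {L} → All P L → All P (beforeFirst u L)
  All-beforeFirst u []                  = []
  All-beforeFirst u {x ∷ L} (px ∷ pL) with u ≡ᵇ x
  ... | true  = []
  ... | false = px ∷ All-beforeFirst u pL

  count-between-bits : ∀ {L} → All PQ L → count q (between p L) ≡ count 1 (between 0 (map bit L))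
  count-between-bits {L} L∈ = begin
    count q (between p L)                 ≡⟨ count-bits (inj₂ refl) (All-beforeFirst p (All-afterFirst p L∈)) ⟩
    count (bit q) (map bit (between p L)) ≡⟨ cong₂ count bit-q (sym (beforeFirst-bits (All-afterFirst p L∈))) ⟩
    count 1 (beforeFirst 0 (map bit (afterFirst p L))) ≡⟨ cong (λ K → count 1 (beforeFirst 0 K)) (afterFirst-bits L∈) ⟨
    count 1 (between 0 (map bit L))       ∎
    where open ≡-Reasoning

  length-PQ : ∀ {L} → All PQ L → length L ≡ count p L + count q L
  length-PQ [] = refl
  length-PQ (inj₁ refl ∷ L∈) rewrite ≡ᵇ-refl p | ≡ᵇ-false-sym p q p≢q = cong suc (length-PQ L∈)
  length-PQ {_ ∷ L} (inj₂ refl ∷ L∈) rewrite ≡ᵇ-refl q | p≢q =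
    trans (cong suc (length-PQ L∈)) (sym (+-suc (count p L) (count q L)))

  data Alternating : List (ℕ × ℕ) → Set where
    pqpq : ∀ c₁ c₂ c₃ c₄ → Alternating ((p , c₁) ∷ (q , c₂) ∷ (p , c₃) ∷ (q , c₄) ∷ [])
    qpqp : ∀ c₁ c₂ c₃ c₄ → Alternating ((q , c₁) ∷ (p , c₂) ∷ (q , c₃) ∷ (p , c₄) ∷ [])

  alternating : ∀ es → length es ≡ 4 → let L = map proj₁ es in All PQ L →
    count p L ≡ 2 → count q L ≡ 2 → count q (between p L) ≡ 1 → Alternating es
  alternating es₄@((a₁ , c₁) ∷ (a₂ , c₂) ∷ (a₃ , c₃) ∷ (a₄ , c₄) ∷ []) _ L∈@(a₁∈ ∷ a₂∈ ∷ a₃∈ ∷ a₄∈ ∷ []) cp cq cb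
    with alternating-bits (bit-Bit a₁ ∷ bit-Bit a₂ ∷ bit-Bit a₃ ∷ bit-Bit a₄ ∷ [])
           (trans (sym (trans (count-bits (inj₁ refl) L∈) (cong (λ b → count b (map bit (map proj₁ es₄))) bit-p))) cp)
           (trans (sym (trans (count-bits (inj₂ refl) L∈) (cong (λ b → count b (map bit (map proj₁ es₄))) bit-q))) cq)
           (trans (sym (count-between-bits L∈)) cb)
  ... | inj₁ (b₁ , b₂ , b₃ , b₄)
    rewrite proj₁ (bit-decode a₁∈) b₁ | proj₂ (bit-decode a₂∈) b₂ | proj₁ (bit-decode a₃∈) b₃ | proj₂ (bit-decode a₄∈) b₄
    = pqpq c₁ c₂ c₃ c₄
  ... | inj₂ (b₁ , b₂ , b₃ , b₄)
    rewrite proj₂ (bit-decode a₁∈) b₁ | proj₁ (bit-decode a₂∈) b₂ | proj₂ (bit-decode a₃∈) b₃ | proj₁ (bit-decode a₄∈) b₄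
    = qpqp c₁ c₂ c₃ c₄
  alternating []                        () _ _ _ _
  alternating (_ ∷ [])                  () _ _ _ _
  alternating (_ ∷ _ ∷ [])              () _ _ _ _
  alternating (_ ∷ _ ∷ _ ∷ [])          () _ _ _ _
  alternating (_ ∷ _ ∷ _ ∷ _ ∷ _ ∷ _)   () _ _ _ _

  module _ (n : ℕ) (π : List ℕ) (hπ : π ↭ map suc (upTo n)) where
    open PointerWord n
    open FramedPermutation n π hπ
    open Cutting n p q

    marked-pointers : map proj₁ (marked 0 F) ≡ onlyPQ p q (ptrSeq n π)
    marked-pointers = map-proj₁-filterP p q (annot n 0 F)

    count-marked : ∀ u → PQ u → u ≤ n → count u (map proj₁ (marked 0 F)) ≡ 2
    count-marked u u∈ u≤n = begin
      count u (map proj₁ (marked 0 F))   ≡⟨ cong (count u) marked-pointers ⟩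
      count u (onlyPQ p q (ptrSeq n π))  ≡⟨ count-onlyPQ u u∈ (ptrSeq n π) ⟩
      count u (ptrSeq n π)               ≡⟨ cong (count u) (ptrSeq≡pointerWord π) ⟩
      count u (pointerWord F)            ≡⟨ count-pointerWord-F u u≤n ⟩
      2                                  ∎
      where open ≡-Reasoning

    marked-alternating : p ≤ n → q ≤ n → count q (between p (ptrSeq n π)) ≡ 1 → Alternating (marked 0 F)
    marked-alternating p≤n q≤n cb = alternating (marked 0 F) length-marked marked∈ cp cq cb′
      where
      marked∈ : All PQ (map proj₁ (marked 0 F))
      marked∈ = subst (All PQ) (sym marked-pointers) (onlyPQ-PQ (ptrSeq n π))
      cp : count p (map proj₁ (marked 0 F)) ≡ 2
      cp = count-marked p (inj₁ refl) p≤n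
      cq : count q (map proj₁ (marked 0 F)) ≡ 2
      cq = count-marked q (inj₂ refl) q≤n
      length-marked : length (marked 0 F) ≡ 4
      length-marked = trans (sym (length-map proj₁ (marked 0 F))) (trans (length-PQ marked∈) (cong₂ _+_ cp cq))
      cb′ : count q (between p (map proj₁ (marked 0 F))) ≡ 1
      cb′ = begin
        count q (between p (map proj₁ (marked 0 F)))   ≡⟨ cong (λ L → count q (between p L)) marked-pointers ⟩
        count q (between p (onlyPQ p q (ptrSeq n π)))  ≡⟨ cong (count q) (between-onlyPQ (ptrSeq n π)) ⟩
        count q (onlyPQ p q (between p (ptrSeq n π)))  ≡⟨ count-onlyPQ q (inj₂ refl) (between p (ptrSeq n π)) ⟩
        count q (between p (ptrSeq n π))               ≡⟨ cb ⟩
        1                                              ∎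
        where open ≡-Reasoning

    cds-defined : nonRoot n p ≡ true → nonRoot n q ≡ true → p ≤ n → q ≤ n →
      count q (between p (ptrSeq n π)) ≡ 1 → is-just (cds n π p q) ≡ true
    cds-defined nrp nrq p≤n q≤n cb with marked 0 F | marked-alternating p≤n q≤n cb
    ... | _ | pqpq _ _ _ _ rewrite nrp | nrq | p≢q | ≡ᵇ-refl p | ≡ᵇ-refl q = refl
    ... | _ | qpqp _ _ _ _ rewrite nrp | nrq | p≢q | ≡ᵇ-refl p | ≡ᵇ-refl q | ≡ᵇ-false-sym p q p≢q = refl

overlaps⇒cds-defined : ∀ n π → π ↭ map suc (upTo n) → ∀ p q → nonRoot n p ≡ true → nonRoot n q ≡ true →
  p ≤ n → q ≤ n → overlaps p q (ptrSeq n π) ≡ true → is-just (cds n π p q) ≡ true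
overlaps⇒cds-defined n π hπ p q nrp nrq p≤n q≤n crossing =
  CdsDefinedness.cds-defined p q (overlaps⇒≢ p q (ptrSeq n π) crossing) n π hπ nrp nrq p≤n q≤n
    (overlaps⇒count p q (ptrSeq n π) crossing)

module _ (n : ℕ) (π : List ℕ) where

  OG-edge : ∀ a b → (if toℕ a ≡ᵇ toℕ b then false else OG n π a b) ≡ overlaps (toℕ a) (toℕ b) (ptrSeq n π)
  OG-edge a b with toℕ a ≡ᵇ toℕ b
  ... | true  = refl
  ... | false = refl

  gcds-defined : ∀ x y → is-just (gcds n (OG n π) x y) ≡ true ⇔
    (nonRoot n (toℕ x) ∧ nonRoot n (toℕ y) ∧ overlaps (toℕ x) (toℕ y) (ptrSeq n π)) ≡ true
  gcds-defined x y = mk⇔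
    (λ h → trans (sym edge≡) (Equivalence.to (is-just-if condition) h))
    (λ h → Equivalence.from (is-just-if condition) (trans edge≡ h))
    where
    condition : Bool
    condition = nonRoot n (toℕ x) ∧ nonRoot n (toℕ y) ∧ (if toℕ x ≡ᵇ toℕ y then false else OG n π x y)
    edge≡ : condition ≡ (nonRoot n (toℕ x) ∧ nonRoot n (toℕ y) ∧ overlaps (toℕ x) (toℕ y) (ptrSeq n π))
    edge≡ = cong (λ e → nonRoot n (toℕ x) ∧ nonRoot n (toℕ y) ∧ e) (OG-edge x y)

  gcds⇒graph : ∀ x y {G} → gcds n (OG n π) x y ≡ just G → ∀ u v →
    G u v ≡ (if toℕ u ≡ᵇ toℕ v then false else
             gcdsEdge (λ a b → overlaps a b (ptrSeq n π)) (toℕ x) (toℕ y) (toℕ u) (toℕ v))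
  gcds⇒graph x y h u v with if-just h
  ... | _ , refl = if-else-cong (toℕ u ≡ᵇ toℕ v) λ _ →
    cong₂ _xor_ (cong₂ _xor_ (cong₂ _∧_ (OG-edge x u) (OG-edge y v)) (cong₂ _∧_ (OG-edge y u) (OG-edge x v)))
                (OG-edge u v)

mainTheorem4 : (n : ℕ) (π : List ℕ) → π ↭ map suc (upTo n) →
    (p q : Fin (suc n)) → 1 ≤ toℕ p → toℕ p < n → 1 ≤ toℕ q → toℕ q < n →
    ((is-just (gcds n (OG n π) p q) ≡ true) ⇔ (is-just (cds n π (toℕ p) (toℕ q)) ≡ true))
    × (∀ (G : Graph n) (π′ : List ℕ) → gcds n (OG n π) p q ≡ just G →
        cds n π (toℕ p) (toℕ q) ≡ just π′ → ∀ u v → G u v ≡ OG n π′ u v)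
mainTheorem4 n π hπ p q 1≤p p<n 1≤q q<n = mk⇔ gcds⇒cds cds⇒gcds , graphs-agree
  where
  P Q : ℕ
  P = toℕ p
  Q = toℕ q
  open SwapOfFramed n π hπ P Q using (cds⇒overlaps; cds⇒graph)
  nonRoot-P : nonRoot n P ≡ true
  nonRoot-P = nonRoot-true 1≤p p<n
  nonRoot-Q : nonRoot n Q ≡ true
  nonRoot-Q = nonRoot-true 1≤q q<n
  gcds⇒cds : is-just (gcds n (OG n π) p q) ≡ true → is-just (cds n π P Q) ≡ true
  gcds⇒cds h = overlaps⇒cds-defined n π hπ P Q nonRoot-P nonRoot-Q (<⇒≤ p<n) (<⇒≤ q<n)
    (∧-conicalʳ (nonRoot n Q) _ (∧-conicalʳ (nonRoot n P) _ (Equivalence.to (gcds-defined n π p q) h)))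
  cds⇒gcds : is-just (cds n π P Q) ≡ true → is-just (gcds n (OG n π) p q) ≡ true
  cds⇒gcds h with is-just⇒just (cds n π P Q) h
  ... | _ , hc = Equivalence.from (gcds-defined n π p q)
    (cong₂ _∧_ nonRoot-P (cong₂ _∧_ nonRoot-Q (cds⇒overlaps p<n q<n hc)))
  graphs-agree : ∀ G π′ → gcds n (OG n π) p q ≡ just G → cds n π P Q ≡ just π′ → ∀ u v → G u v ≡ OG n π′ u v
  graphs-agree G π′ hG hc u v = trans (gcds⇒graph n π p q hG u v) (sym (cds⇒graph p<n q<n hc u v))
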